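{- Let $0<h<n$. Then $$\langle\nu(\bullet;h)\rangle:=\frac{1}{q^n}\sum_{A\in\mathcal M_n}\nu(A;h)=q^{h+1}\Bigl(1-\frac{1}{q^n}\Bigr).$$
   Context: $\mathcal M_n$ is the set of monic polynomials of degree $n$ in $\mathbb F_q[T]$, and $\mathcal P_{\le h}$ the set of polynomials of degree at most $h$ including $0$. The von Mangoldt function is $\Lambda(N)=\deg P$ if $N=cP^k$ with $P$ monic irreducible, $k\geq1$, $c\in\mathbb F_q^\times$, and $\Lambda(N)=0$ otherwise. For $A$ of degree $n$, $I(A;h)=A+\mathcal P_{\le h}$ and $\nu(A;h)=\sum_{f\in I(A;h),\ f(0)\neq0}\Lambda(f)$. -}

module Defs where

open import Level using (0ℓ)
open import Data.Bool using (Bool; true; false; _∧_; _∨_; not; if_then_else_)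
open import Data.Nat using (ℕ; zero; suc; _∸_; _<_; _≤?_)
open import Data.List using (List; []; _∷_; map; concatMap; length; upTo; _++_; [_])
open import Data.Nat.ListAction using (sum)
open import Data.Bool.ListAction using (any)
open import Data.Vec using (Vec; toList) renaming ([] to []ᵥ; _∷_ to _∷ᵥ_)
open import Data.List.Properties using (≡-dec)
open import Data.List.Relation.Unary.Unique.Propositional using (Unique)
open import Data.List.Membership.Propositional using (_∈_)
open import Data.Product using (∃)
open import Relation.Nullary.Decidable using (⌊_⌋)
open import Relation.Binary.PropositionalEquality using (_≡_; _≢_)
open import Relation.Binary.Definitions using (DecidableEquality)
open import Algebra.Structures using (IsCommutativeRing)

record FiniteField : Set₁ where
  infixl 7 _*_
  infixl 6 _+_
  field
    Carrier           : Set
    _≟_               : DecidableEquality Carrier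
    _+_ _*_           : Carrier → Carrier → Carrier
    -_                : Carrier → Carrier
    0# 1#             : Carrier
    isCommutativeRing : IsCommutativeRing _≡_ _+_ _*_ -_ 0# 1#
    0≢1               : 0# ≢ 1#
    inverse           : ∀ x → x ≢ 0# → ∃ λ y → x * y ≡ 1#
    elements          : List Carrier
    elements-unique   : Unique elements
    elements-complete : ∀ x → x ∈ elements

module _ (F : FiniteField) where
  open FiniteField F

  card : ℕ
  card = length elements

  -- Polynomials in F[T] as coefficient lists, constant coefficient first.
  Poly : Set
  Poly = List Carrier

  addP : Poly → Poly → Poly
  addP []       ys       = ys
  addP (x ∷ xs) []       = x ∷ xs
  addP (x ∷ xs) (y ∷ ys) = (x + y) ∷ addP xs ys

  scaleP : Carrier → Poly → Poly
  scaleP c = map (c *_)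

  mulP : Poly → Poly → Poly
  mulP []       ys = []
  mulP (x ∷ xs) ys = addP (scaleP x ys) (0# ∷ mulP xs ys)

  powP : Poly → ℕ → Poly
  powP p zero    = 1# ∷ []
  powP p (suc k) = mulP p (powP p k)

  monic : ∀ {d} → Vec Carrier d → Poly
  monic v = toList v ++ [ 1# ]

  allVecs : (d : ℕ) → List (Vec Carrier d)
  allVecs zero    = []ᵥ ∷ []
  allVecs (suc d) = concatMap (λ x → map (x ∷ᵥ_) (allVecs d)) elements

  Monics : ℕ → List Poly
  Monics d = map monic (allVecs d)

  _==_ : Poly → Poly → Bool
  p == r = ⌊ ≡-dec _≟_ p r ⌋

  -- a monic P of degree d is irreducible iff d ≥ 1 and P is not a product
  -- of two monic polynomials of degrees i, d-i with 1 ≤ i ≤ d-1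
  -- (monic products of monic lists have exact length, so list equality is
  -- polynomial equality here)
  isIrreducible : (d : ℕ) → Vec Carrier d → Bool
  isIrreducible d v =
    ⌊ 1 ≤? d ⌋ ∧
    not (any (λ i → ⌊ 1 ≤? i ⌋ ∧
               any (λ a → any (λ b → mulP a b == monic v) (Monics (d ∸ i)))
                   (Monics i))
             (upTo d))

  isNonzero : Carrier → Bool
  isNonzero c = not ⌊ c ≟ 0# ⌋

  -- von Mangoldt: Λ(f) = deg P if f = c P^k, P monic irreducible, k ≥ 1,
  -- c ≠ 0; else 0.  We sum deg P over all such representations (c,P,k) with
  -- deg P ≤ deg-bound and k ≤ deg-bound; by unique factorisation there is at
  -- most one, and any representation of f of degree N has deg P, k ≤ N.
  ΛN : ℕ → Poly → ℕ
  ΛN N f =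
    sum (map (λ d →
      sum (map (λ v →
        sum (map (λ k →
          sum (map (λ c →
            if isNonzero c ∧ ⌊ 1 ≤? k ⌋ ∧ isIrreducible d v
                 ∧ (scaleP c (powP (monic v) k) == f)
            then d else 0) elements)) (upTo (suc N)))) (allVecs d))) (upTo (suc N)))

  -- Λ(f) with bound = length f (≥ degree of f)
  Λ : Poly → ℕ
  Λ f = ΛN (length f) f

  constCoeff : Poly → Carrier
  constCoeff []      = 0#
  constCoeff (c ∷ _) = c

  -- ν(A;h) = Σ_{f ∈ A + P_{≤h}, f(0) ≠ 0} Λ(f), P_{≤h} = all polynomials of
  -- degree ≤ h (incl. 0), i.e. all coefficient vectors of length h+1.
  ν : Poly → ℕ → ℕ
  ν A h = sum (map (λ g → let f = addP A (toList g) in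
                           if isNonzero (constCoeff f) then Λ f else 0)
                   (allVecs (suc h)))

module Submission where

-- Writing ν(A;h) = Σ_{g ∈ P_{≤h}} H(A + g) with H(f) = [f(0) ≠ 0] Λ(f),
-- and noting that f ↦ f + g permutes M_n when deg g ≤ h < n, the left side equals
-- q^{h+1} · Σ_{f ∈ M_n} H(f).  It remains to show Σ_{f ∈ M_n, f(0) ≠ 0} Λ(f) = q^n − 1.
-- This is the prime polynomial theorem Σ_{f ∈ M_n} Λ(f) = q^n minus the single term
-- f = T^n, the only prime power of degree n vanishing at 0.
--
-- The prime polynomial theorem is proved from the identity Σ_{D ∣ f} Λ(D) = deg f
-- (unique factorisation, via Euclid's lemma) by counting: summing over f ∈ M_m gives
-- m q^m = Σ_{P^k} deg P · q^{m − k deg P}, and subtracting q times the same identity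
-- for m − 1 isolates Σ_{deg P^k = m} deg P = q^m.

open import Defs
open import Level using (0ℓ)
open import Data.Nat using (ℕ; zero; suc; _+_; _*_; _^_; _∸_; _≤_; _<_; z≤n; s≤s; _≤?_; _<?_; _⊔_; ≢-nonZero)
  renaming (_≟_ to _≟ℕ_)
open import Data.Nat.Properties hiding (_≟_)
open import Data.Nat.ListAction using (sum)
open import Data.Nat.ListAction.Properties using (sum-++)
open import Data.List using (List; []; _∷_; map; length; upTo; concatMap; _++_)
open import Data.List.Properties using (length-map; length-++; ≡-dec; upTo-∷ʳ; map-++; map-∘; map-applyUpTo; map-upTo)
open import Data.List.Membership.Propositional using (_∈_)
open import Data.List.Membership.Propositional.Properties using (∈-map⁺; ∈-map⁻; ∈-++⁺ˡ; ∈-++⁺ʳ; ∈-upTo⁺; ∈-upTo⁻)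
open import Data.List.Relation.Unary.Any using (here; there)
open import Data.List.Relation.Unary.All using (All; _∷_)
open import Data.List.Relation.Unary.Unique.Propositional using (Unique)
open import Data.List.Relation.Unary.Unique.Propositional.Properties using (upTo⁺)
open import Data.List.Relation.Unary.AllPairs using (_∷_)
open import Data.Bool using (Bool; true; false; _∧_; not; if_then_else_)
open import Data.Bool.ListAction using (any)
open import Data.Vec using (Vec; toList) renaming ([] to []ᵥ; _∷_ to _∷ᵥ_)
open import Data.Vec.Properties using (length-toList)
open import Data.Product using (Σ; _,_; proj₁; proj₂; _×_)
open import Data.Sum using (_⊎_; inj₁; inj₂)
open import Data.Empty using (⊥-elim)
open import Function using (_∘_)
open import Relation.Nullary using (Dec; yes; no; ¬_)
open import Relation.Nullary.Decidable using (⌊_⌋)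
open import Relation.Binary.PropositionalEquality
open import Relation.Binary.Bundles using (Setoid)
open import Algebra.Bundles using (CommutativeRing)
import Relation.Binary.Reasoning.Setoid as SetoidReasoning
import Algebra.Properties.Ring as RingProperties
open import Algebra.Properties.CommutativeSemigroup +-commutativeSemigroup using () renaming (interchange to ℕ-interchange)


module Sums where

  Σl : ∀ {A : Set} → List A → (A → ℕ) → ℕ
  Σl xs f = sum (map f xs)

  module _ {A : Set} where

    Σ-cong : ∀ (xs : List A) {f g : A → ℕ} → (∀ x → f x ≡ g x) → Σl xs f ≡ Σl xs g
    Σ-cong []       e = refl
    Σ-cong (x ∷ xs) e = cong₂ _+_ (e x) (Σ-cong xs e)

    Σ-cong∈ : ∀ (xs : List A) {f g : A → ℕ} → (∀ x → x ∈ xs → f x ≡ g x) → Σl xs f ≡ Σl xs g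
    Σ-cong∈ []       e = refl
    Σ-cong∈ (x ∷ xs) e = cong₂ _+_ (e x (here refl)) (Σ-cong∈ xs (λ y m → e y (there m)))

    Σ-zero : ∀ (xs : List A) → Σl xs (λ _ → 0) ≡ 0
    Σ-zero []       = refl
    Σ-zero (x ∷ xs) = Σ-zero xs

    Σ-+ : ∀ (xs : List A) (f g : A → ℕ) → Σl xs (λ x → f x + g x) ≡ Σl xs f + Σl xs g
    Σ-+ []       f g = refl
    Σ-+ (x ∷ xs) f g = trans (cong ((f x + g x) +_) (Σ-+ xs f g)) (ℕ-interchange (f x) (g x) _ _)

    Σ-*ˡ : ∀ (xs : List A) c (f : A → ℕ) → Σl xs (λ x → c * f x) ≡ c * Σl xs f
    Σ-*ˡ []       c f = sym (*-zeroʳ c)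
    Σ-*ˡ (x ∷ xs) c f = trans (cong (c * f x +_) (Σ-*ˡ xs c f)) (sym (*-distribˡ-+ c (f x) (Σl xs f)))

    Σ-const : ∀ (xs : List A) c → Σl xs (λ _ → c) ≡ c * length xs
    Σ-const []       c = sym (*-zeroʳ c)
    Σ-const (x ∷ xs) c = trans (cong (c +_) (Σ-const xs c)) (sym (*-suc c (length xs)))

    Σ-++ : ∀ (xs ys : List A) (f : A → ℕ) → Σl (xs ++ ys) f ≡ Σl xs f + Σl ys f
    Σ-++ xs ys f = trans (cong sum (map-++ f xs ys)) (sum-++ (map f xs) (map f ys))

    Σ-map : ∀ {B : Set} (xs : List B) (g : B → A) (f : A → ℕ) → Σl (map g xs) f ≡ Σl xs (f ∘ g)
    Σ-map xs g f = cong sum (sym (map-∘ xs))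

    Σ-concatMap : ∀ {B : Set} (xs : List B) (g : B → List A) (f : A → ℕ) →
                  Σl (concatMap g xs) f ≡ Σl xs (λ x → Σl (g x) f)
    Σ-concatMap []       g f = refl
    Σ-concatMap (x ∷ xs) g f = trans (Σ-++ (g x) (concatMap g xs) f) (cong (Σl (g x) f +_) (Σ-concatMap xs g f))

    Σ-if : ∀ (xs : List A) (b : Bool) (f : A → ℕ) →
           Σl xs (λ x → if b then f x else 0) ≡ (if b then Σl xs f else 0)
    Σ-if xs true  f = refl
    Σ-if xs false f = Σ-zero xs

    private
      ∉-All : ∀ {x z} {ys : List A} → z ∈ ys → All (x ≢_) ys → x ≢ z
      ∉-All (here refl) (x≢z ∷ _) = x≢z
      ∉-All (there z∈ys) (_ ∷ ps) = ∉-All z∈ys ps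

    Σ-indicator : (_≟_ : (x y : A) → Dec (x ≡ y)) (xs : List A) → Unique xs → ∀ y → y ∈ xs → ∀ a →
                  Σl xs (λ x → if ⌊ x ≟ y ⌋ then a else 0) ≡ a
    Σ-indicator _≟_ (x ∷ xs) (x∉xs ∷ _) _ (here refl) a with x ≟ x
    ... | no x≢x = ⊥-elim (x≢x refl)
    ... | yes _  = trans (cong (a +_) (trans (Σ-cong∈ xs vanish) (Σ-zero xs))) (+-identityʳ a)
      where
        vanish : ∀ z → z ∈ xs → (if ⌊ z ≟ x ⌋ then a else 0) ≡ 0
        vanish z z∈xs with z ≟ x
        ... | yes refl = ⊥-elim (∉-All z∈xs x∉xs refl)
        ... | no _     = refl
    Σ-indicator _≟_ (x ∷ xs) (x∉xs ∷ u) y (there y∈xs) a with x ≟ y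
    ... | yes refl = ⊥-elim (∉-All y∈xs x∉xs refl)
    ... | no _     = Σ-indicator _≟_ xs u y y∈xs a

  Σ-swap : ∀ {A B : Set} (xs : List A) (ys : List B) (f : A → B → ℕ) →
           Σl xs (λ x → Σl ys (f x)) ≡ Σl ys (λ y → Σl xs (λ x → f x y))
  Σ-swap []       ys f = sym (Σ-zero ys)
  Σ-swap (x ∷ xs) ys f = trans (cong (Σl ys (f x) +_) (Σ-swap xs ys f))
                               (sym (Σ-+ ys (f x) (λ y → Σl xs (λ x' → f x' y))))

  Σ-upTo-first : ∀ n (f : ℕ → ℕ) → Σl (upTo (suc n)) f ≡ f 0 + Σl (upTo n) (f ∘ suc)
  Σ-upTo-first n f = cong (λ xs → f 0 + sum xs)
    (trans (map-applyUpTo suc f n) (sym (map-upTo (f ∘ suc) n)))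

  Σ-upTo-last : ∀ n (f : ℕ → ℕ) → Σl (upTo (suc n)) f ≡ Σl (upTo n) f + f n
  Σ-upTo-last n f = trans (cong (λ xs → Σl xs f) (sym (upTo-∷ʳ n)))
                          (trans (Σ-++ (upTo n) (n ∷ []) f) (cong (Σl (upTo n) f +_) (+-identityʳ (f n))))

  Σ-upTo-indicator : ∀ n m a → m ≤ n → Σl (upTo (suc n)) (λ k → if ⌊ k ≟ℕ m ⌋ then a else 0) ≡ a
  Σ-upTo-indicator n m a m≤n = Σ-indicator _≟ℕ_ (upTo (suc n)) (upTo⁺ (suc n)) m (∈-upTo⁺ (s≤s m≤n)) a

open Sums

module Indicators where

  true≢false : true ≢ false
  true≢false ()

  bool-ext : ∀ {b₁ b₂ : Bool} → (b₁ ≡ true → b₂ ≡ true) → (b₂ ≡ true → b₁ ≡ true) → b₁ ≡ b₂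
  bool-ext {true}  {true}  _ _ = refl
  bool-ext {true}  {false} f _ = sym (f refl)
  bool-ext {false} {true}  _ g = g refl
  bool-ext {false} {false} _ _ = refl

  ⌊⌋-true : ∀ {Q : Set} (dq : Dec Q) → ⌊ dq ⌋ ≡ true → Q
  ⌊⌋-true (yes q) _ = q

  true-⌊⌋ : ∀ {Q : Set} (dq : Dec Q) → Q → ⌊ dq ⌋ ≡ true
  true-⌊⌋ (yes _) _ = refl
  true-⌊⌋ (no ¬q) q = ⊥-elim (¬q q)

  ∧-true : ∀ {a b} → (a ∧ b) ≡ true → a ≡ true × b ≡ true
  ∧-true {true} {true} _ = refl , refl

  if-∧ : ∀ a b (d : ℕ) → (if a ∧ b then d else 0) ≡ (if a then (if b then d else 0) else 0)
  if-∧ true  b d = refl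
  if-∧ false b d = refl

  if-∧∧ : ∀ a b c (d : ℕ) → (if a ∧ b ∧ c then d else 0) ≡ (if a ∧ b then (if c then d else 0) else 0)
  if-∧∧ true true  c d = refl
  if-∧∧ true false c d = refl
  if-∧∧ false b    c d = refl

  if-swap : ∀ a b (d : ℕ) → (if a then (if b then d else 0) else 0) ≡ (if b then (if a then d else 0) else 0)
  if-swap true  b d = refl
  if-swap false true  d = refl
  if-swap false false d = refl

  ∧-shuffle : ∀ a b c z → (b ∧ a) ∧ (c ∧ z) ≡ (a ∧ b ∧ c) ∧ z
  ∧-shuffle true  true  c z = refl
  ∧-shuffle true  false c z = refl
  ∧-shuffle false true  c z = refl
  ∧-shuffle false false c z = refl

  ⌊≟⌋-sym : ∀ m n → ⌊ m ≟ℕ n ⌋ ≡ ⌊ n ≟ℕ m ⌋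
  ⌊≟⌋-sym m n = bool-ext (λ e → true-⌊⌋ (n ≟ℕ m) (sym (⌊⌋-true (m ≟ℕ n) e))) (λ e → true-⌊⌋ (m ≟ℕ n) (sym (⌊⌋-true (n ≟ℕ m) e)))

  if-cong : ∀ {b b'} {d d' : ℕ} → b ≡ b' → (b ≡ true → d ≡ d') → (if b then d else 0) ≡ (if b' then d' else 0)
  if-cong {true}  refl e = e refl
  if-cong {false} refl e = refl

  any-intro : ∀ {A : Set} (f : A → Bool) xs x → x ∈ xs → f x ≡ true → any f xs ≡ true
  any-intro f (y ∷ xs) x (here refl) e rewrite e = refl
  any-intro f (y ∷ xs) x (there m)   e with f y
  ... | true  = refl
  ... | false = any-intro f xs x m e

  any-elim : ∀ {A : Set} (f : A → Bool) xs → any f xs ≡ true → Σ A λ x → x ∈ xs × f x ≡ true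
  any-elim f (y ∷ xs) e with f y in eq
  ... | true  = y , here refl , eq
  ... | false = let (x , m , fx) = any-elim f xs e in x , there m , fx

  ∈-concatMap : ∀ {A B : Set} (f : A → List B) {xs y z} → z ∈ xs → y ∈ f z → y ∈ concatMap f xs
  ∈-concatMap f {x ∷ xs} (here refl) m = ∈-++⁺ˡ m
  ∈-concatMap f {x ∷ xs} (there mz)  m = ∈-++⁺ʳ (f x) (∈-concatMap f mz m)

open Indicators

-- The polynomial ring F[T] on coefficient lists.  Lists with trailing zeros represent
-- the same polynomial, so the ring laws hold up to coefficientwise equality _≈_.
module PolynomialRing (F : FiniteField) where
  open FiniteField F public using (Carrier; 0#; 1#; 0≢1; inverse; elements; elements-unique; elements-complete)
    renaming (_≟_ to _≟F_; _+_ to _+F_; _*_ to _*F_; -_ to -F_)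

  CR : CommutativeRing 0ℓ 0ℓ
  CR = record { isCommutativeRing = FiniteField.isCommutativeRing F }
  module C = CommutativeRing CR
  open import Algebra.Properties.CommutativeSemigroup C.+-commutativeSemigroup using ()
    renaming (interchange to F-interchange) public

  P : Set
  P = Poly F

  infixl 6 _⊕_
  infixl 7 _⊗_
  _⊕_ _⊗_ : P → P → P
  _⊕_ = addP F
  _⊗_ = mulP F

  sc : Carrier → P → P
  sc = scaleP F

  sh : P → P
  sh p = 0# ∷ p

  coef : P → ℕ → Carrier
  coef []       _       = 0#
  coef (x ∷ _)  zero    = x
  coef (_ ∷ xs) (suc i) = coef xs i

  infix 4 _≈_
  record _≈_ (p r : P) : Set where
    constructor mk
    field at : ∀ i → coef p i ≡ coef r i
  open _≈_ public

  ≈-refl : ∀ {p} → p ≈ p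
  ≈-refl = mk λ _ → refl
  ≈-sym : ∀ {p r} → p ≈ r → r ≈ p
  ≈-sym e = mk λ i → sym (at e i)
  ≈-trans : ∀ {p r s} → p ≈ r → r ≈ s → p ≈ s
  ≈-trans e f = mk λ i → trans (at e i) (at f i)
  ≡⇒≈ : ∀ {p r} → p ≡ r → p ≈ r
  ≡⇒≈ refl = ≈-refl

  ≈-setoid : Setoid 0ℓ 0ℓ
  ≈-setoid = record { Carrier = P ; _≈_ = _≈_
                    ; isEquivalence = record { refl = ≈-refl ; sym = ≈-sym ; trans = ≈-trans } }
  module ≈-Reasoning = SetoidReasoning ≈-setoid

  -- The coefficient maps of the operations; every ring law below reduces to these.
  coef-⊕ : ∀ p r i → coef (p ⊕ r) i ≡ coef p i +F coef r i
  coef-⊕ []      r       i       = sym (C.+-identityˡ _)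
  coef-⊕ (x ∷ p) []      i       = sym (C.+-identityʳ _)
  coef-⊕ (x ∷ p) (y ∷ r) zero    = refl
  coef-⊕ (x ∷ p) (y ∷ r) (suc i) = coef-⊕ p r i

  coef-sc : ∀ c p i → coef (sc c p) i ≡ c *F coef p i
  coef-sc c []      i       = sym (C.zeroʳ c)
  coef-sc c (x ∷ p) zero    = refl
  coef-sc c (x ∷ p) (suc i) = coef-sc c p i

  ⊕-pointwise : ∀ p r s t → (∀ i → coef p i +F coef r i ≡ coef s i +F coef t i) → p ⊕ r ≈ s ⊕ t
  ⊕-pointwise p r s t e = mk λ i → trans (coef-⊕ p r i) (trans (e i) (sym (coef-⊕ s t i)))

  ⊕-cong : ∀ {p p' r r'} → p ≈ p' → r ≈ r' → p ⊕ r ≈ p' ⊕ r'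
  ⊕-cong {p} {p'} {r} {r'} e f = ⊕-pointwise p r p' r' λ i → cong₂ _+F_ (at e i) (at f i)

  ⊕-comm : ∀ p r → p ⊕ r ≈ r ⊕ p
  ⊕-comm p r = ⊕-pointwise p r r p λ i → C.+-comm _ _

  ⊕-assoc : ∀ p r s → (p ⊕ r) ⊕ s ≈ p ⊕ (r ⊕ s)
  ⊕-assoc p r s = mk λ i → begin
    coef ((p ⊕ r) ⊕ s) i              ≡⟨ trans (coef-⊕ (p ⊕ r) s i) (cong (_+F coef s i) (coef-⊕ p r i)) ⟩
    (coef p i +F coef r i) +F coef s i ≡⟨ C.+-assoc _ _ _ ⟩
    coef p i +F (coef r i +F coef s i) ≡⟨ sym (trans (coef-⊕ p (r ⊕ s) i) (cong (coef p i +F_) (coef-⊕ r s i))) ⟩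
    coef (p ⊕ (r ⊕ s)) i              ∎
    where open ≡-Reasoning

  ⊕-identityʳ : ∀ p → p ⊕ [] ≈ p
  ⊕-identityʳ []      = ≈-refl
  ⊕-identityʳ (x ∷ p) = ≈-refl

  ⊕-interchange : ∀ a b c d → (a ⊕ b) ⊕ (c ⊕ d) ≈ (a ⊕ c) ⊕ (b ⊕ d)
  ⊕-interchange a b c d = mk λ i → begin
    coef ((a ⊕ b) ⊕ (c ⊕ d)) i
      ≡⟨ trans (coef-⊕ (a ⊕ b) (c ⊕ d) i) (cong₂ _+F_ (coef-⊕ a b i) (coef-⊕ c d i)) ⟩
    (coef a i +F coef b i) +F (coef c i +F coef d i)
      ≡⟨ F-interchange _ _ _ _ ⟩
    (coef a i +F coef c i) +F (coef b i +F coef d i)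
      ≡⟨ sym (trans (coef-⊕ (a ⊕ c) (b ⊕ d) i) (cong₂ _+F_ (coef-⊕ a c i) (coef-⊕ b d i))) ⟩
    coef ((a ⊕ c) ⊕ (b ⊕ d)) i ∎
    where open ≡-Reasoning

  sc-pointwise : ∀ c p s → (∀ i → c *F coef p i ≡ coef s i) → sc c p ≈ s
  sc-pointwise c p s e = mk λ i → trans (coef-sc c p i) (e i)

  sc-cong : ∀ {c p r} → p ≈ r → sc c p ≈ sc c r
  sc-cong {c} {p} {r} e = sc-pointwise c p (sc c r) λ i → trans (cong (c *F_) (at e i)) (sym (coef-sc c r i))

  sc-⊕ : ∀ c p r → sc c (p ⊕ r) ≈ sc c p ⊕ sc c r
  sc-⊕ c p r = sc-pointwise c (p ⊕ r) _ λ i → trans (cong (c *F_) (coef-⊕ p r i)) (trans (C.distribˡ c _ _)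
                 (sym (trans (coef-⊕ (sc c p) (sc c r) i) (cong₂ _+F_ (coef-sc c p i) (coef-sc c r i)))))

  sc-+ : ∀ c d p → sc (c +F d) p ≈ sc c p ⊕ sc d p
  sc-+ c d p = sc-pointwise (c +F d) p _ λ i → trans (C.distribʳ _ c d)
                 (sym (trans (coef-⊕ (sc c p) (sc d p) i) (cong₂ _+F_ (coef-sc c p i) (coef-sc d p i))))

  sc-sc : ∀ c d p → sc c (sc d p) ≈ sc (c *F d) p
  sc-sc c d p = sc-pointwise c (sc d p) _ λ i → trans (cong (c *F_) (coef-sc d p i))
                  (trans (sym (C.*-assoc _ _ _)) (sym (coef-sc (c *F d) p i)))

  sc-0 : ∀ p → sc 0# p ≈ []
  sc-0 p = sc-pointwise 0# p [] λ i → C.zeroˡ _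

  sc-1 : ∀ p → sc 1# p ≈ p
  sc-1 p = sc-pointwise 1# p p λ i → C.*-identityˡ _

  sh-cong : ∀ {p r} → p ≈ r → sh p ≈ sh r
  sh-cong e = mk λ { zero → refl ; (suc i) → at e i }

  sh-⊕ : ∀ p r → sh (p ⊕ r) ≈ sh p ⊕ sh r
  sh-⊕ p r = mk λ { zero → sym (C.+-identityˡ _) ; (suc i) → refl }

  sh-[] : sh [] ≈ []
  sh-[] = mk λ { zero → refl ; (suc i) → refl }

  sc-sh : ∀ c p → sc c (sh p) ≈ sh (sc c p)
  sc-sh c p = mk λ { zero → C.zeroʳ c ; (suc i) → refl }

  cons≈ : ∀ {x y p r} → x ≡ y → p ≈ r → (x ∷ p) ≈ (y ∷ r)
  cons≈ e f = mk λ { zero → e ; (suc i) → at f i }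

  head≈ : ∀ {x y p r} → (x ∷ p) ≈ (y ∷ r) → x ≡ y
  head≈ e = at e zero

  tail≈ : ∀ {x y p r} → (x ∷ p) ≈ (y ∷ r) → p ≈ r
  tail≈ e = mk λ i → at e (suc i)

  head≈[] : ∀ {x p} → (x ∷ p) ≈ [] → x ≡ 0#
  head≈[] e = at e zero

  tail≈[] : ∀ {x p} → (x ∷ p) ≈ [] → p ≈ []
  tail≈[] e = mk λ i → at e (suc i)

  cons≈[] : ∀ {x p} → x ≡ 0# → p ≈ [] → (x ∷ p) ≈ []
  cons≈[] e f = mk λ { zero → e ; (suc i) → at f i }

  cons-split : ∀ x p → (x ∷ p) ≈ (x ∷ []) ⊕ sh p
  cons-split x p = mk λ { zero → sym (C.+-identityʳ x) ; (suc i) → refl }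

  ⊗-zeroˡ : ∀ p r → p ≈ [] → p ⊗ r ≈ []
  ⊗-zeroˡ []      r e = ≈-refl
  ⊗-zeroˡ (x ∷ p) r e = ⊕-cong (≈-trans (≡⇒≈ (cong (λ c → sc c r) (head≈[] e))) (sc-0 r))
                               (≈-trans (sh-cong (⊗-zeroˡ p r (tail≈[] e))) sh-[])

  ⊗-zeroʳ : ∀ p → p ⊗ [] ≈ []
  ⊗-zeroʳ []      = ≈-refl
  ⊗-zeroʳ (x ∷ p) = ≈-trans (sh-cong (⊗-zeroʳ p)) sh-[]

  ⊗-congˡ : ∀ {p q} r → p ≈ q → p ⊗ r ≈ q ⊗ r
  ⊗-congˡ {[]}    {q}     r e = ≈-sym (⊗-zeroˡ q r (≈-sym e))
  ⊗-congˡ {x ∷ p} {[]}    r e = ⊗-zeroˡ (x ∷ p) r e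
  ⊗-congˡ {x ∷ p} {y ∷ q} r e = ⊕-cong (≡⇒≈ (cong (λ c → sc c r) (head≈ e))) (sh-cong (⊗-congˡ r (tail≈ e)))

  ⊗-congʳ : ∀ p {r s} → r ≈ s → p ⊗ r ≈ p ⊗ s
  ⊗-congʳ []      e = ≈-refl
  ⊗-congʳ (x ∷ p) e = ⊕-cong (sc-cong e) (sh-cong (⊗-congʳ p e))

  ⊗-distribʳ : ∀ a b c → (a ⊕ b) ⊗ c ≈ a ⊗ c ⊕ b ⊗ c
  ⊗-distribʳ []      b       c = ≈-refl
  ⊗-distribʳ (x ∷ a) []      c = ≈-sym (⊕-identityʳ _)
  ⊗-distribʳ (x ∷ a) (y ∷ b) c = begin
    sc (x +F y) c ⊕ sh ((a ⊕ b) ⊗ c)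
      ≈⟨ ⊕-cong (sc-+ x y c) (≈-trans (sh-cong (⊗-distribʳ a b c)) (sh-⊕ (a ⊗ c) (b ⊗ c))) ⟩
    (sc x c ⊕ sc y c) ⊕ (sh (a ⊗ c) ⊕ sh (b ⊗ c))
      ≈⟨ ⊕-interchange (sc x c) (sc y c) (sh (a ⊗ c)) (sh (b ⊗ c)) ⟩
    (sc x c ⊕ sh (a ⊗ c)) ⊕ (sc y c ⊕ sh (b ⊗ c)) ∎
    where open ≈-Reasoning

  ⊗-distribˡ : ∀ a b c → a ⊗ (b ⊕ c) ≈ a ⊗ b ⊕ a ⊗ c
  ⊗-distribˡ []      b c = ≈-refl
  ⊗-distribˡ (x ∷ a) b c = begin
    sc x (b ⊕ c) ⊕ sh (a ⊗ (b ⊕ c))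
      ≈⟨ ⊕-cong (sc-⊕ x b c) (≈-trans (sh-cong (⊗-distribˡ a b c)) (sh-⊕ (a ⊗ b) (a ⊗ c))) ⟩
    (sc x b ⊕ sc x c) ⊕ (sh (a ⊗ b) ⊕ sh (a ⊗ c))
      ≈⟨ ⊕-interchange (sc x b) (sc x c) (sh (a ⊗ b)) (sh (a ⊗ c)) ⟩
    (sc x b ⊕ sh (a ⊗ b)) ⊕ (sc x c ⊕ sh (a ⊗ c)) ∎
    where open ≈-Reasoning

  ⊗-shʳ : ∀ a b → a ⊗ sh b ≈ sh (a ⊗ b)
  ⊗-shʳ []      b = ≈-sym sh-[]
  ⊗-shʳ (x ∷ a) b = begin
    sc x (sh b) ⊕ sh (a ⊗ sh b)      ≈⟨ ⊕-cong (sc-sh x b) (sh-cong (⊗-shʳ a b)) ⟩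
    sh (sc x b) ⊕ sh (sh (a ⊗ b))    ≈⟨ ≈-sym (sh-⊕ (sc x b) (sh (a ⊗ b))) ⟩
    sh (sc x b ⊕ sh (a ⊗ b))         ∎
    where open ≈-Reasoning

  ⊗-shˡ : ∀ a b → sh a ⊗ b ≈ sh (a ⊗ b)
  ⊗-shˡ a b = ⊕-cong (sc-0 b) ≈-refl

  ⊗-scˡ : ∀ c a b → sc c a ⊗ b ≈ sc c (a ⊗ b)
  ⊗-scˡ c []      b = ≈-refl
  ⊗-scˡ c (x ∷ a) b = begin
    sc (c *F x) b ⊕ sh (sc c a ⊗ b)
      ≈⟨ ⊕-cong (≈-sym (sc-sc c x b)) (≈-trans (sh-cong (⊗-scˡ c a b)) (≈-sym (sc-sh c (a ⊗ b)))) ⟩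
    sc c (sc x b) ⊕ sc c (sh (a ⊗ b))
      ≈⟨ ≈-sym (sc-⊕ c (sc x b) (sh (a ⊗ b))) ⟩
    sc c (sc x b ⊕ sh (a ⊗ b)) ∎
    where open ≈-Reasoning

  ⊗-scʳ : ∀ c a b → a ⊗ sc c b ≈ sc c (a ⊗ b)
  ⊗-scʳ c []      b = ≈-refl
  ⊗-scʳ c (x ∷ a) b = begin
    sc x (sc c b) ⊕ sh (a ⊗ sc c b)
      ≈⟨ ⊕-cong (≈-trans (sc-sc x c b) (≈-trans (≡⇒≈ (cong (λ y → sc y b) (C.*-comm x c))) (≈-sym (sc-sc c x b))))
                (≈-trans (sh-cong (⊗-scʳ c a b)) (≈-sym (sc-sh c (a ⊗ b)))) ⟩
    sc c (sc x b) ⊕ sc c (sh (a ⊗ b))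
      ≈⟨ ≈-sym (sc-⊕ c (sc x b) (sh (a ⊗ b))) ⟩
    sc c (sc x b ⊕ sh (a ⊗ b)) ∎
    where open ≈-Reasoning

  ⊗-const : ∀ b x → b ⊗ (x ∷ []) ≈ sc x b
  ⊗-const []      x = ≈-refl
  ⊗-const (y ∷ b) x = begin
    sc y (x ∷ []) ⊕ sh (b ⊗ (x ∷ []))  ≈⟨ ⊕-cong (≈-refl {sc y (x ∷ [])}) (sh-cong (⊗-const b x)) ⟩
    (y *F x ∷ []) ⊕ sh (sc x b)        ≈⟨ cons≈ (trans (C.+-identityʳ _) (C.*-comm y x)) ≈-refl ⟩
    sc x (y ∷ b)                       ∎
    where open ≈-Reasoning

  ⊗-comm : ∀ a b → a ⊗ b ≈ b ⊗ a
  ⊗-comm []      b = ≈-sym (⊗-zeroʳ b)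
  ⊗-comm (x ∷ a) b = begin
    sc x b ⊕ sh (a ⊗ b)         ≈⟨ ⊕-cong (≈-sym (⊗-const b x)) (≈-trans (sh-cong (⊗-comm a b)) (≈-sym (⊗-shʳ b a))) ⟩
    b ⊗ (x ∷ []) ⊕ b ⊗ sh a     ≈⟨ ≈-sym (⊗-distribˡ b (x ∷ []) (sh a)) ⟩
    b ⊗ ((x ∷ []) ⊕ sh a)       ≈⟨ ⊗-congʳ b (≈-sym (cons-split x a)) ⟩
    b ⊗ (x ∷ a)                 ∎
    where open ≈-Reasoning

  ⊗-assoc : ∀ a b c → (a ⊗ b) ⊗ c ≈ a ⊗ (b ⊗ c)
  ⊗-assoc []      b c = ≈-refl
  ⊗-assoc (x ∷ a) b c = begin
    (sc x b ⊕ sh (a ⊗ b)) ⊗ c        ≈⟨ ⊗-distribʳ (sc x b) (sh (a ⊗ b)) c ⟩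
    sc x b ⊗ c ⊕ sh (a ⊗ b) ⊗ c      ≈⟨ ⊕-cong (⊗-scˡ x b c) (≈-trans (⊗-shˡ (a ⊗ b) c) (sh-cong (⊗-assoc a b c))) ⟩
    sc x (b ⊗ c) ⊕ sh (a ⊗ (b ⊗ c))  ∎
    where open ≈-Reasoning

  one : P
  one = 1# ∷ []

  ⊗-identityˡ : ∀ b → one ⊗ b ≈ b
  ⊗-identityˡ b = ≈-trans (⊗-comm one b) (≈-trans (⊗-const b 1#) (sc-1 b))

  ⊗-identityʳ : ∀ p → p ⊗ one ≈ p
  ⊗-identityʳ p = ≈-trans (⊗-const p 1#) (sc-1 p)

  neg : P → P
  neg = sc (-F 1#)

  coef-neg : ∀ p i → coef (neg p) i ≡ -F coef p i
  coef-neg p i = trans (coef-sc (-F 1#) p i) (RingProperties.-1*x≈-x C.ring _)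

  ⊕-inverseʳ : ∀ p → p ⊕ neg p ≈ []
  ⊕-inverseʳ p = mk λ i → trans (coef-⊕ p (neg p) i) (trans (cong (coef p i +F_) (coef-neg p i)) (C.-‿inverseʳ _))

  ⊗-neg : ∀ a b → a ⊗ neg b ≈ neg (a ⊗ b)
  ⊗-neg a b = ⊗-scʳ (-F 1#) a b

  ⊗-negˡ : ∀ a b → neg a ⊗ b ≈ neg (a ⊗ b)
  ⊗-negˡ a b = ⊗-scˡ (-F 1#) a b

  difference≈0 : ∀ p r → p ⊕ neg r ≈ [] → p ≈ r
  difference≈0 p r e = mk λ i → begin
    coef p i                                   ≡⟨ C.+-identityʳ _ ⟨
    coef p i +F 0#                             ≡⟨ cong (coef p i +F_) (C.-‿inverseˡ (coef r i)) ⟨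
    coef p i +F (-F coef r i +F coef r i)      ≡⟨ C.+-assoc _ _ _ ⟨
    (coef p i +F -F coef r i) +F coef r i      ≡⟨ cong (_+F coef r i) (trans (cong (coef p i +F_) (sym (coef-neg r i)))
                                                    (trans (sym (coef-⊕ p (neg r) i)) (at e i))) ⟩
    0# +F coef r i                             ≡⟨ C.+-identityˡ _ ⟩
    coef r i                                   ∎
    where open ≡-Reasoning

  isolate : ∀ {f X r} → f ≈ X ⊕ r → r ≈ f ⊕ neg X
  isolate {f} {X} {r} e = ≈-sym (begin
    f ⊕ neg X              ≈⟨ ⊕-cong e (≈-refl {neg X}) ⟩
    (X ⊕ r) ⊕ neg X        ≈⟨ ⊕-cong (⊕-comm X r) (≈-refl {neg X}) ⟩
    (r ⊕ X) ⊕ neg X        ≈⟨ ⊕-assoc r X (neg X) ⟩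
    r ⊕ (X ⊕ neg X)        ≈⟨ ⊕-cong (≈-refl {r}) (⊕-inverseʳ X) ⟩
    r ⊕ []                 ≈⟨ ⊕-identityʳ r ⟩
    r                      ∎)
    where open ≈-Reasoning

  infix 4 _∣_
  record _∣_ (g f : P) : Set where
    constructor _,_
    field
      cofactor : P
      factorisation : f ≈ g ⊗ cofactor

  ∣-resp-≈ : ∀ {g f f'} → g ∣ f → f ≈ f' → g ∣ f'
  ∣-resp-≈ (z , e) e' = z , ≈-trans (≈-sym e') e

  ∣-refl⊗ : ∀ g w → g ∣ g ⊗ w
  ∣-refl⊗ g w = w , ≈-refl

  ∣-trans : ∀ {g h f} → g ∣ h → h ∣ f → g ∣ f
  ∣-trans {g} (z , e) (y , e') = z ⊗ y , ≈-trans e' (≈-trans (⊗-congˡ y e) (⊗-assoc g z y))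

  ∣-⊗ʳ : ∀ {g f} → g ∣ f → ∀ w → g ∣ f ⊗ w
  ∣-⊗ʳ {g} (z , e) w = z ⊗ w , ≈-trans (⊗-congˡ w e) (⊗-assoc g z w)

  ∣-⊗ˡ : ∀ {g f} w → g ∣ f → g ∣ w ⊗ f
  ∣-⊗ˡ {g} {f} w d = ∣-resp-≈ (∣-⊗ʳ d w) (⊗-comm f w)

  ∣-⊕ : ∀ {g f₁ f₂} → g ∣ f₁ → g ∣ f₂ → g ∣ f₁ ⊕ f₂
  ∣-⊕ {g} (z₁ , e₁) (z₂ , e₂) = z₁ ⊕ z₂ , ≈-trans (⊕-cong e₁ e₂) (≈-sym (⊗-distribˡ g z₁ z₂))

  ∣-neg : ∀ {g f} → g ∣ f → g ∣ neg f
  ∣-neg {g} (z , e) = neg z , ≈-trans (sc-cong e) (≈-sym (⊗-neg g z))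

  ∣-sc : ∀ {g f} c → g ∣ f → g ∣ sc c f
  ∣-sc {g} c (z , e) = sc c z , ≈-trans (sc-cong e) (≈-sym (⊗-scʳ c g z))

  one∣ : ∀ g → one ∣ g
  one∣ g = g , ≈-sym (⊗-identityˡ g)

  ∣-⊗-both : ∀ {A C} q → A ∣ C → q ⊗ A ∣ q ⊗ C
  ∣-⊗-both {A} q (z , eq) = z , ≈-trans (⊗-congʳ q eq) (≈-sym (⊗-assoc q A z))

module MonicDivision (F : FiniteField) where
  open PolynomialRing F

  coef-beyond : ∀ p i → length p ≤ i → coef p i ≡ 0#
  coef-beyond []      i       _         = refl
  coef-beyond (x ∷ p) (suc i) (s≤s le)  = coef-beyond p i le

  coef≢0⇒< : ∀ p i → coef p i ≢ 0# → i < length p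
  coef≢0⇒< p i ne with i <? length p
  ... | yes lt  = lt
  ... | no  nlt = ⊥-elim (ne (coef-beyond p i (≮⇒≥ nlt)))

  record DegBelow (m : ℕ) (p : P) : Set where
    constructor below
    field vanish : ∀ i → m ≤ i → coef p i ≡ 0#
  open DegBelow public

  DegBelow-≈ : ∀ {m p r} → p ≈ r → DegBelow m p → DegBelow m r
  DegBelow-≈ e s = below λ i le → trans (sym (at e i)) (vanish s i le)

  DegBelow-mono : ∀ {m m' p} → m ≤ m' → DegBelow m p → DegBelow m' p
  DegBelow-mono le s = below λ i le' → vanish s i (≤-trans le le')

  DegBelow-[] : ∀ {m} → DegBelow m []
  DegBelow-[] = below λ _ _ → refl

  DegBelow-0 : ∀ {p} → DegBelow 0 p → p ≈ []
  DegBelow-0 s = mk λ i → vanish s i z≤n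

  record Monic (d : ℕ) (p : P) : Set where
    constructor monicₚ
    field
      length≡ : length p ≡ suc d
      leading : coef p d ≡ 1#
  open Monic public

  Monic-beyond : ∀ {d g} → Monic d g → ∀ i → suc d ≤ i → coef g i ≡ 0#
  Monic-beyond {g = g} mg i le = coef-beyond g i (subst (_≤ i) (sym (length≡ mg)) le)

  Monic-deg-unique : ∀ {d e q} → Monic d q → Monic e q → d ≡ e
  Monic-deg-unique a b = suc-injective (trans (sym (length≡ a)) (length≡ b))

  Monic-one : Monic 0 one
  Monic-one = monicₚ refl refl

  Monic-0 : ∀ {m} → Monic 0 m → m ≡ one
  Monic-0 {x ∷ []}    (monicₚ _ t) = cong (_∷ []) t
  Monic-0 {x ∷ y ∷ m} (monicₚ () _)

  -- If g is monic of degree d and deg (z g) < d, then z = 0: by induction on z, the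
  -- tail z satisfies the same bound, and then coefficient d of z g is z₀.
  degree-bound : ∀ {d g} → Monic d g → ∀ z → DegBelow d (z ⊗ g) → z ≈ []
  degree-bound mg []       s = ≈-refl
  degree-bound {d} {g} mg (z₀ ∷ z) s = cons≈[] z₀≡0 z≈0
    where
      coef-step : ∀ i → coef ((z₀ ∷ z) ⊗ g) (suc i) ≡ z₀ *F coef g (suc i) +F coef (z ⊗ g) i
      coef-step i = trans (coef-⊕ (sc z₀ g) (sh (z ⊗ g)) (suc i)) (cong (_+F coef (z ⊗ g) i) (coef-sc z₀ g (suc i)))
      tail-small : DegBelow d (z ⊗ g)
      tail-small = below λ j le → begin
        coef (z ⊗ g) j                           ≡⟨ C.+-identityˡ _ ⟨
        0# +F coef (z ⊗ g) j                     ≡⟨ cong (_+F coef (z ⊗ g) j) (trans (cong (z₀ *F_) (Monic-beyond mg (suc j) (s≤s le))) (C.zeroʳ z₀)) ⟨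
        z₀ *F coef g (suc j) +F coef (z ⊗ g) j   ≡⟨ trans (sym (coef-step j)) (vanish s (suc j) (m≤n⇒m≤1+n le)) ⟩
        0#                                       ∎
        where open ≡-Reasoning
      z≈0 : z ≈ []
      z≈0 = degree-bound mg z tail-small
      z₀≡0 : z₀ ≡ 0#
      z₀≡0 = begin
        z₀                                       ≡⟨ trans (C.+-identityʳ _) (C.*-identityʳ z₀) ⟨
        z₀ *F 1# +F 0#                           ≡⟨ cong₂ (λ a b → z₀ *F a +F b) (sym (leading mg)) (sym (sh-vanish d)) ⟩
        z₀ *F coef g d +F coef (sh (z ⊗ g)) d    ≡⟨ trans (cong (_+F coef (sh (z ⊗ g)) d) (sym (coef-sc z₀ g d))) (sym (coef-⊕ (sc z₀ g) (sh (z ⊗ g)) d)) ⟩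
        coef ((z₀ ∷ z) ⊗ g) d                    ≡⟨ vanish s d ≤-refl ⟩
        0#                                       ∎
        where
          open ≡-Reasoning
          sh-vanish : ∀ i → coef (sh (z ⊗ g)) i ≡ 0#
          sh-vanish zero    = refl
          sh-vanish (suc i) = at (⊗-zeroˡ z g z≈0) i

  degree-boundʳ : ∀ {d g} → Monic d g → ∀ z → DegBelow d (g ⊗ z) → z ≈ []
  degree-boundʳ {g = g} mg z s = degree-bound mg z (DegBelow-≈ (⊗-comm g z) s)

  ⊗-cancelˡ : ∀ {d g} → Monic d g → ∀ a b → g ⊗ a ≈ g ⊗ b → a ≈ b
  ⊗-cancelˡ {d} {g} mg a b e =
    difference≈0 a b (degree-boundʳ mg (a ⊕ neg b) (DegBelow-≈ (≈-sym g[a-b]≈0) DegBelow-[]))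
    where
      g[a-b]≈0 : g ⊗ (a ⊕ neg b) ≈ []
      g[a-b]≈0 = ≈-trans (⊗-distribˡ g a (neg b)) (≈-trans (⊕-cong e (⊗-neg g b)) (⊕-inverseʳ (g ⊗ b)))

  ∣-cancelˡ : ∀ {e q A C} → Monic e q → q ⊗ A ∣ q ⊗ C → A ∣ C
  ∣-cancelˡ {e} {q} {A} {C} mq (z , eq) = z , ⊗-cancelˡ mq C (A ⊗ z) (≈-trans eq (⊗-assoc q A z))

  -- Long division by g, one coefficient of f at a time (highest coefficient last in the
  -- list, so the recursion processes f from its top degree down).
  divmod : P → P → P × P
  divmod g []      = [] , []
  divmod g (x ∷ f) = let (t , r) = divmod g f ; c = coef (x ∷ r) (length g ∸ 1) in
                     sh t ⊕ (c ∷ []) , (x ∷ r) ⊕ sc (-F c) g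

  quo rem : P → P → P
  quo g f = proj₁ (divmod g f)
  rem g f = proj₂ (divmod g f)

  division-step : ∀ g x f t r c → f ≈ g ⊗ t ⊕ r → (x ∷ f) ≈ g ⊗ (sh t ⊕ (c ∷ [])) ⊕ ((x ∷ r) ⊕ sc (-F c) g)
  division-step g x f t r c f≈gt+r = mk λ i → sym (begin
    coef (g ⊗ (sh t ⊕ (c ∷ [])) ⊕ (w ⊕ sc (-F c) g)) i
      ≡⟨ at (⊕-cong (≈-trans (⊗-distribˡ g (sh t) (c ∷ [])) (⊕-cong (⊗-shʳ g t) (⊗-const g c))) (≈-refl {w ⊕ sc (-F c) g})) i ⟩
    coef ((sh (g ⊗ t) ⊕ sc c g) ⊕ (w ⊕ sc (-F c) g)) i
      ≡⟨ trans (coef-⊕ (sh (g ⊗ t) ⊕ sc c g) (w ⊕ sc (-F c) g) i)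
               (cong₂ _+F_ (trans (coef-⊕ (sh (g ⊗ t)) (sc c g) i) (cong (coef (sh (g ⊗ t)) i +F_) (coef-sc c g i)))
                           (trans (coef-⊕ w (sc (-F c) g) i) (cong (coef w i +F_) (coef-sc (-F c) g i)))) ⟩
    (coef (sh (g ⊗ t)) i +F c *F coef g i) +F (coef w i +F (-F c) *F coef g i)
      ≡⟨ cancel _ _ (coef g i) ⟩
    coef (sh (g ⊗ t)) i +F coef w i
      ≡⟨ shifted i ⟩
    coef (x ∷ f) i ∎)
    where
      open ≡-Reasoning
      w = x ∷ r
      cancel : ∀ a b h → (a +F c *F h) +F (b +F (-F c) *F h) ≡ a +F b
      cancel a b h = trans (F-interchange a (c *F h) b ((-F c) *F h))
        (trans (cong ((a +F b) +F_) (trans (sym (C.distribʳ h c (-F c))) (trans (cong (_*F h) (C.-‿inverseʳ c)) (C.zeroˡ h))))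
          (C.+-identityʳ _))
      shifted : ∀ i → coef (sh (g ⊗ t)) i +F coef w i ≡ coef (x ∷ f) i
      shifted zero    = C.+-identityˡ x
      shifted (suc i) = trans (sym (coef-⊕ (g ⊗ t) r i)) (sym (at f≈gt+r i))

  division-step-small : ∀ {d g} → Monic d g → ∀ x r → DegBelow d r →
                        DegBelow d ((x ∷ r) ⊕ sc (-F coef (x ∷ r) (length g ∸ 1)) g)
  division-step-small {d} {g} mg x r r<d = below λ i le →
    trans (coef-⊕ w (sc (-F c) g) i) (trans (cong (coef w i +F_) (coef-sc (-F c) g i)) (kill i le))
    where
      w = x ∷ r
      c = coef w (length g ∸ 1)
      c≡w_d : c ≡ coef w d
      c≡w_d = cong (coef w ∘ (_∸ 1)) (length≡ mg)
      kill : ∀ i → d ≤ i → coef w i +F (-F c) *F coef g i ≡ 0#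
      kill i le with m≤n⇒m<n∨m≡n le
      ... | inj₂ refl = trans (cong₂ (λ a b → a +F (-F c) *F b) (sym c≡w_d) (leading mg))
                              (trans (cong (c +F_) (C.*-identityʳ _)) (C.-‿inverseʳ c))
      ... | inj₁ lt with i
      ...   | suc j = trans (cong₂ (λ a b → a +F (-F c) *F b) (vanish r<d j (≤-pred lt)) (Monic-beyond mg (suc j) lt))
                            (trans (C.+-identityˡ _) (C.zeroʳ _))

  record DivisionSpec (d : ℕ) (g f : P) : Set where
    field
      division  : f ≈ g ⊗ quo g f ⊕ rem g f
      remainder : DegBelow d (rem g f)
  open DivisionSpec public

  divmod-spec : ∀ {d g} → Monic d g → ∀ f → DivisionSpec d g f
  divmod-spec {d} {g} mg [] = record
    { division  = mk λ i → sym (trans (coef-⊕ (g ⊗ []) [] i) (trans (cong (_+F 0#) (at (⊗-zeroʳ g) i)) (C.+-identityʳ _)))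
    ; remainder = DegBelow-[] }
  divmod-spec {d} {g} mg (x ∷ f) = record
    { division  = division-step g x f (quo g f) (rem g f) _ (division ih)
    ; remainder = division-step-small mg x (rem g f) (remainder ih) }
    where ih = divmod-spec mg f

  isZero : P → Bool
  isZero []      = true
  isZero (x ∷ p) = ⌊ x ≟F 0# ⌋ ∧ isZero p

  isZero-sound : ∀ p → isZero p ≡ true → p ≈ []
  isZero-sound []      _ = ≈-refl
  isZero-sound (x ∷ p) e  with x ≟F 0# | isZero p in ep
  isZero-sound (x ∷ p) e  | yes x≡0 | true = cons≈[] x≡0 (isZero-sound p ep)
  isZero-sound (x ∷ p) () | yes _   | false
  isZero-sound (x ∷ p) () | no _    | _

  isZero-complete : ∀ p → p ≈ [] → isZero p ≡ true
  isZero-complete []      _ = refl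
  isZero-complete (x ∷ p) e with x ≟F 0#
  ... | yes _  = isZero-complete p (tail≈[] e)
  ... | no x≢0 = ⊥-elim (x≢0 (head≈[] e))

  divides? : P → P → Bool
  divides? g f = isZero (rem g f)

  divides?-sound : ∀ {d g} → Monic d g → ∀ f → divides? g f ≡ true → g ∣ f
  divides?-sound mg f e = quo _ f , ≈-trans (division (divmod-spec mg f))
                                      (≈-trans (⊕-cong ≈-refl (isZero-sound _ e)) (⊕-identityʳ _))

  divides?-complete : ∀ {d g} → Monic d g → ∀ f → g ∣ f → divides? g f ≡ true
  divides?-complete {d} {g} mg f (z , f≈gz) = isZero-complete _ r≈0
    where
      t = quo g f
      r = rem g f
      spec = divmod-spec mg f
      g[z-t]≈r : g ⊗ (z ⊕ neg t) ≈ r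
      g[z-t]≈r = begin
        g ⊗ (z ⊕ neg t)               ≈⟨ ⊗-distribˡ g z (neg t) ⟩
        g ⊗ z ⊕ g ⊗ neg t             ≈⟨ ⊕-cong (≈-trans (≈-sym f≈gz) (division spec)) (⊗-neg g t) ⟩
        (g ⊗ t ⊕ r) ⊕ neg (g ⊗ t)     ≈⟨ ≈-sym (isolate {X = g ⊗ t} ≈-refl) ⟩
        r                             ∎
        where open ≈-Reasoning
      r≈0 : r ≈ []
      r≈0 = ≈-trans (≈-sym g[z-t]≈r)
              (≈-trans (⊗-congʳ g (degree-boundʳ mg _ (DegBelow-≈ (≈-sym g[z-t]≈r) (remainder spec))))
                (⊗-zeroʳ g))

  length-⊕ : ∀ p r → length (p ⊕ r) ≡ length p ⊔ length r
  length-⊕ []      r       = refl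
  length-⊕ (x ∷ p) []      = refl
  length-⊕ (x ∷ p) (y ∷ r) = cong suc (length-⊕ p r)

  length-⊗ : ∀ x p y r → length ((x ∷ p) ⊗ (y ∷ r)) ≡ suc (length p + length r)
  length-⊗ x []       y r = cong suc (trans (length-⊕ (map (x *F_) r) []) (trans (⊔-identityʳ _) (length-map (x *F_) r)))
  length-⊗ x (x' ∷ p) y r = cong suc (trans (length-⊕ (map (x *F_) r) _)
    (trans (cong (length (map (x *F_) r) ⊔_) (length-⊗ x' p y r))
      (m≤n⇒m⊔n≡n (subst (_≤ suc (length p + length r)) (sym (length-map (x *F_) r)) (m≤n⇒m≤1+n (m≤n+m (length r) (length p)))))))

  top-⊗ : ∀ x p y r → coef ((x ∷ p) ⊗ (y ∷ r)) (length p + length r) ≡ coef (x ∷ p) (length p) *F coef (y ∷ r) (length r)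
  top-⊗ x []       y r = trans (coef-⊕ (sc x (y ∷ r)) (sh []) (length r))
                           (trans (cong₂ _+F_ (coef-sc x (y ∷ r) (length r)) (at sh-[] (length r))) (C.+-identityʳ _))
  top-⊗ x (x' ∷ p) y r = trans (coef-⊕ (sc x (y ∷ r)) (sh ((x' ∷ p) ⊗ (y ∷ r))) (suc (length p + length r)))
    (trans (cong (_+F _) (trans (coef-sc x (y ∷ r) (suc (length p + length r))) (trans (cong (x *F_) high-coef) (C.zeroʳ x))))
      (trans (C.+-identityˡ _) (top-⊗ x' p y r)))
    where
      high-coef : coef (y ∷ r) (suc (length p + length r)) ≡ 0#
      high-coef = coef-beyond (y ∷ r) _ (s≤s (m≤n+m (length r) (length p)))

  Monic-⊗ : ∀ {d e p r} → Monic d p → Monic e r → Monic (d + e) (p ⊗ r)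
  Monic-⊗ {p = x ∷ p} {y ∷ r} (monicₚ refl cp) (monicₚ refl cr) =
    monicₚ (length-⊗ x p y r) (trans (top-⊗ x p y r) (trans (cong₂ _*F_ cp cr) (C.*-identityʳ 1#)))

  ≈-same-length : ∀ p r → length p ≡ length r → p ≈ r → p ≡ r
  ≈-same-length []      []      _ _ = refl
  ≈-same-length (x ∷ p) (y ∷ r) l e = cong₂ _∷_ (head≈ e) (≈-same-length p r (suc-injective l) (tail≈ e))

  Monic-≈ : ∀ {d e p r} → Monic d p → Monic e r → p ≈ r → p ≡ r
  Monic-≈ {d} {e} {p} {r} mp mr p≈r =
    ≈-same-length p r (trans (length≡ mp) (sym (trans (length≡ mr) (cong suc (sym d≡e))))) p≈r
    where
      d≡e : d ≡ e
      d≡e = ≤-antisym (≮⇒≥ λ lt → 0≢1 (trans (sym (Monic-beyond mr d lt)) (trans (sym (at p≈r d)) (leading mp))))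
                      (≮⇒≥ λ lt → 0≢1 (trans (sym (Monic-beyond mp e lt)) (trans (at p≈r e) (leading mr))))

  trimCons : (x : Carrier) → P → P
  trimCons x []      with x ≟F 0#
  ... | yes _ = []
  ... | no  _ = x ∷ []
  trimCons x (y ∷ s) = x ∷ y ∷ s

  trim : P → P
  trim []      = []
  trim (x ∷ p) = trimCons x (trim p)

  trimCons≈ : ∀ x s → trimCons x s ≈ (x ∷ s)
  trimCons≈ x []      with x ≟F 0#
  ... | yes x≡0 = ≈-sym (cons≈[] x≡0 ≈-refl)
  ... | no  _   = ≈-refl
  trimCons≈ x (y ∷ s) = ≈-refl

  trim≈ : ∀ p → trim p ≈ p
  trim≈ []      = ≈-refl
  trim≈ (x ∷ p) = ≈-trans (trimCons≈ x (trim p)) (cons≈ refl (trim≈ p))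

  data Trimmed : P → Set where
    zeroₜ : Trimmed []
    topₜ  : ∀ {y s} → coef (y ∷ s) (length s) ≢ 0# → Trimmed (y ∷ s)

  trim-Trimmed : ∀ p → Trimmed (trim p)
  trim-Trimmed []      = zeroₜ
  trim-Trimmed (x ∷ p) = step (trim p) (trim-Trimmed p)
    where
      step : ∀ s → Trimmed s → Trimmed (trimCons x s)
      step [] zeroₜ with x ≟F 0#
      ... | yes _   = zeroₜ
      ... | no  x≢0 = topₜ x≢0
      step (y ∷ s) (topₜ top≢0) = topₜ top≢0

  normalise : ∀ y s → coef (y ∷ s) (length s) ≢ 0# → Σ Carrier λ u → Monic (length s) (sc u (y ∷ s))
  normalise y s top≢0 = let (u , top·u≡1) = inverse _ top≢0 in
    u , monicₚ (cong suc (length-map (u *F_) s))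
               (trans (coef-sc u (y ∷ s) (length s)) (trans (C.*-comm u _) top·u≡1))

  record MonicCofactor (n e : ℕ) (f g : P) : Set where
    field
      cofactor       : P
      cofactor-monic : Monic (n ∸ e) cofactor
      deg≤           : e ≤ n
      product        : f ≡ g ⊗ cofactor
  open MonicCofactor public

  monicCofactor : ∀ {n e f g} → Monic n f → Monic e g → g ∣ f → MonicCofactor n e f g
  monicCofactor {n} {e} {f} {g} mf mg (h , f≈gh) with trim h | trim≈ h | trim-Trimmed h
  ... | [] | t≈h | zeroₜ =
    ⊥-elim (0≢1 (trans (sym (at (≈-trans f≈gh (≈-trans (⊗-congʳ g (≈-sym t≈h)) (⊗-zeroʳ g))) n)) (leading mf)))
  ... | y ∷ s | t≈h | topₜ top≢0 = compare-tops g mg (≈-trans f≈gh (⊗-congʳ g (≈-sym t≈h)))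
    where
      k = length s
      c = coef (y ∷ s) k
      compare-tops : ∀ g → Monic e g → f ≈ g ⊗ (y ∷ s) → MonicCofactor n e f g
      compare-tops (x ∷ g') (monicₚ refl g-top) f≈g·ys = record
        { cofactor = y ∷ s ; cofactor-monic = subst (λ j → Monic j (y ∷ s)) k≡n∸e monic-ys
        ; deg≤ = subst (e ≤_) (sym n≡e+k) (m≤m+n e k)
        ; product = Monic-≈ mf (Monic-⊗ {e} (monicₚ refl g-top) monic-ys) f≈g·ys }
        where
          top-coef : coef ((x ∷ g') ⊗ (y ∷ s)) (e + k) ≡ c
          top-coef = trans (top-⊗ x g' y s) (trans (cong (_*F c) g-top) (C.*-identityˡ c))
          n≤e+k : n ≤ e + k
          n≤e+k = ≤-pred (subst (n <_) (length-⊗ x g' y s)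
                    (coef≢0⇒< _ n (λ z → 0≢1 (trans (sym z) (trans (sym (at f≈g·ys n)) (leading mf))))))
          e+k≤n : e + k ≤ n
          e+k≤n = ≤-pred (subst (e + k <_) (length≡ mf)
                    (coef≢0⇒< f (e + k) (λ z → top≢0 (trans (sym top-coef) (trans (sym (at f≈g·ys (e + k))) z)))))
          n≡e+k : n ≡ e + k
          n≡e+k = ≤-antisym n≤e+k e+k≤n
          monic-ys : Monic k (y ∷ s)
          monic-ys = monicₚ refl (trans (sym top-coef) (trans (sym (at f≈g·ys (e + k))) (trans (cong (coef f) (sym n≡e+k)) (leading mf))))
          k≡n∸e : k ≡ n ∸ e
          k≡n∸e = trans (sym (m+n∸m≡n e k)) (cong (_∸ e) (sym n≡e+k))

  ∣-deg : ∀ {e m q g} → Monic e q → Monic m g → q ∣ g → e ≤ m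
  ∣-deg mq mg q∣g = deg≤ (monicCofactor mg mq q∣g)

module Enumeration (F : FiniteField) where
  open PolynomialRing F
  open MonicDivision F

  q : ℕ
  q = card F

  infix 5 _=?_
  _=?_ : P → P → Bool
  p =? r = _==_ F p r

  =?-sound : ∀ p r → p =? r ≡ true → p ≡ r
  =?-sound p r e with ≡-dec _≟F_ p r
  ... | yes p≡r = p≡r

  =?-refl : ∀ p → p =? p ≡ true
  =?-refl p = true-⌊⌋ (≡-dec _≟F_ p p) refl

  =?-≡ : ∀ {p r} → p ≡ r → p =? r ≡ true
  =?-≡ {p} refl = =?-refl p

  =?-sym : ∀ a b → a =? b ≡ b =? a
  =?-sym a b = bool-ext (λ e → =?-≡ (sym (=?-sound a b e))) (λ e → =?-≡ (sym (=?-sound b a e)))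

  =?-∷ : ∀ x y a b → (x ∷ a) =? (y ∷ b) ≡ (⌊ x ≟F y ⌋ ∧ (a =? b))
  =?-∷ x y a b = bool-ext to from
    where
      to : (x ∷ a) =? (y ∷ b) ≡ true → (⌊ x ≟F y ⌋ ∧ (a =? b)) ≡ true
      to e with =?-sound _ _ e
      ... | refl rewrite true-⌊⌋ (x ≟F x) refl = =?-refl a
      from : (⌊ x ≟F y ⌋ ∧ (a =? b)) ≡ true → (x ∷ a) =? (y ∷ b) ≡ true
      from e = let (x≡y , a≡b) = ∧-true e in
        =?-≡ (cong₂ _∷_ (⌊⌋-true (x ≟F y) x≡y) (=?-sound a b a≡b))

  allVecs-complete : ∀ {d} (v : Vec Carrier d) → v ∈ allVecs F d
  allVecs-complete []ᵥ       = here refl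
  allVecs-complete (x ∷ᵥ v) = ∈-concatMap (λ x → map (x ∷ᵥ_) (allVecs F _)) (elements-complete x)
                                          (∈-map⁺ (x ∷ᵥ_) (allVecs-complete v))

  monic-Monic : ∀ {d} (v : Vec Carrier d) → Monic d (monic F v)
  monic-Monic {d} v = monicₚ (trans (length-++ (toList v)) (trans (+-comm _ 1) (cong suc (length-toList v))))
                             (subst (λ k → coef (toList v ++ one) k ≡ 1#) (length-toList v) (top (toList v)))
    where
      top : ∀ xs → coef (xs ++ one) (length xs) ≡ 1#
      top []       = refl
      top (x ∷ xs) = top xs

  Monic-monic : ∀ {d p} → Monic d p → Σ (Vec Carrier d) λ v → p ≡ monic F v
  Monic-monic {zero}  {x ∷ []}     (monicₚ _ t)  = []ᵥ , cong (_∷ []) t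
  Monic-monic {zero}  {x ∷ y ∷ p}  (monicₚ () _)
  Monic-monic {suc d} {x ∷ p}      (monicₚ l t)  = let (v , e) = Monic-monic {d} {p} (monicₚ (suc-injective l) t) in
                                                   x ∷ᵥ v , cong (x ∷_) e

  Monic⇒∈Monics : ∀ {d p} → Monic d p → p ∈ Monics F d
  Monic⇒∈Monics m = let (v , e) = Monic-monic m in subst (_∈ Monics F _) (sym e) (∈-map⁺ (monic F) (allVecs-complete v))

  ∈Monics⇒Monic : ∀ {d p} → p ∈ Monics F d → Monic d p
  ∈Monics⇒Monic m = let (v , _ , e) = ∈-map⁻ (monic F) m in subst (Monic _) (sym e) (monic-Monic v)

  length-allVecs : ∀ d → length (allVecs F d) ≡ q ^ d
  length-allVecs zero    = refl
  length-allVecs (suc d) = begin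
    length (concatMap (λ x → map (x ∷ᵥ_) (allVecs F d)) elements)  ≡⟨ length-concatMap elements ⟩
    Σl elements (λ x → length (map (x ∷ᵥ_) (allVecs F d)))         ≡⟨ Σ-cong elements (λ x → trans (length-map (x ∷ᵥ_) (allVecs F d)) (length-allVecs d)) ⟩
    Σl elements (λ _ → q ^ d)                                      ≡⟨ Σ-const elements (q ^ d) ⟩
    q ^ d * q                                                      ≡⟨ *-comm (q ^ d) q ⟩
    q ^ suc d                                                      ∎
    where
      open ≡-Reasoning
      length-concatMap : ∀ {A B : Set} {f : A → List B} xs → length (concatMap f xs) ≡ Σl xs (λ x → length (f x))
      length-concatMap []       = refl
      length-concatMap {f = f} (x ∷ xs) = trans (length-++ (f x)) (cong (length (f x) +_) (length-concatMap xs))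

  length-Monics : ∀ d → length (Monics F d) ≡ q ^ d
  length-Monics d = trans (length-map (monic F) (allVecs F d)) (length-allVecs d)

  Σ-allVecs-indicator : ∀ d p a → Monic d p → Σl (allVecs F d) (λ v → if monic F v =? p then a else 0) ≡ a
  Σ-allVecs-indicator zero p a mp rewrite Monic-0 mp = trans (cong (λ b → (if b then a else 0) + 0) (=?-refl one)) (+-identityʳ a)
  Σ-allVecs-indicator (suc d) (y ∷ p) a (monicₚ l t) = begin
    Σl (concatMap (λ x → map (x ∷ᵥ_) (allVecs F d)) elements) G
      ≡⟨ Σ-concatMap elements (λ x → map (x ∷ᵥ_) (allVecs F d)) G ⟩
    Σl elements (λ x → Σl (map (x ∷ᵥ_) (allVecs F d)) G)
      ≡⟨ Σ-cong elements (λ x → trans (Σ-map (allVecs F d) (x ∷ᵥ_) G) (split x)) ⟩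
    Σl elements (λ x → if ⌊ x ≟F y ⌋ then Σl (allVecs F d) (λ v → if monic F v =? p then a else 0) else 0)
      ≡⟨ Σ-cong elements (λ x → cong (λ z → if ⌊ x ≟F y ⌋ then z else 0) (Σ-allVecs-indicator d p a (monicₚ (suc-injective l) t))) ⟩
    Σl elements (λ x → if ⌊ x ≟F y ⌋ then a else 0)
      ≡⟨ Σ-indicator _≟F_ elements elements-unique y (elements-complete y) a ⟩
    a ∎
    where
      open ≡-Reasoning
      G : Vec Carrier (suc d) → ℕ
      G v = if monic F v =? (y ∷ p) then a else 0
      -- the head coordinate must be y, the tail is a vector for p
      split : ∀ x → Σl (allVecs F d) (G ∘ (x ∷ᵥ_)) ≡ (if ⌊ x ≟F y ⌋ then Σl (allVecs F d) (λ v → if monic F v =? p then a else 0) else 0)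
      split x = trans (Σ-cong (allVecs F d) (λ v → trans (cong (λ b → if b then a else 0) (=?-∷ x y (monic F v) p)) (if-∧ ⌊ x ≟F y ⌋ _ a)))
                      (Σ-if (allVecs F d) ⌊ x ≟F y ⌋ (λ v → if monic F v =? p then a else 0))

  Σ-allVecs-absent : ∀ d p a → ¬ Monic d p → Σl (allVecs F d) (λ v → if monic F v =? p then a else 0) ≡ 0
  Σ-allVecs-absent d p a ¬mp = trans (Σ-cong (allVecs F d) absent) (Σ-zero (allVecs F d))
    where
      absent : ∀ v → (if monic F v =? p then a else 0) ≡ 0
      absent v with monic F v =? p in e
      ... | true  = ⊥-elim (¬mp (subst (Monic d) (=?-sound _ _ e) (monic-Monic v)))
      ... | false = refl

  Σ-Monics-indicator : ∀ {e p} → Monic e p → ∀ m a →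
                       Σl (Monics F m) (λ f → if f =? p then a else 0) ≡ (if ⌊ m ≟ℕ e ⌋ then a else 0)
  Σ-Monics-indicator {e} {p} mp m a with m ≟ℕ e
  ... | yes refl = trans (Σ-map (allVecs F m) (monic F) _) (Σ-allVecs-indicator m p a mp)
  ... | no  m≢e  = trans (Σ-map (allVecs F m) (monic F) _) (Σ-allVecs-absent m p a (λ mp' → m≢e (Monic-deg-unique mp' mp)))

  Σ-allMonics-indicator : ∀ B {e p} → Monic e p → e ≤ B → (φ : ℕ → ℕ) →
    Σl (upTo (suc B)) (λ d → Σl (allVecs F d) (λ v → if monic F v =? p then φ d else 0)) ≡ φ e
  Σ-allMonics-indicator B {e} {p} mp e≤B φ =
    trans (Σ-cong (upTo (suc B)) at-degree) (Σ-upTo-indicator B e (φ e) e≤B)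
    where
      at-degree : ∀ d → Σl (allVecs F d) (λ v → if monic F v =? p then φ d else 0) ≡ (if ⌊ d ≟ℕ e ⌋ then φ e else 0)
      at-degree d = trans (sym (Σ-map (allVecs F d) (monic F) (λ f → if f =? p then φ d else 0)))
                          (trans (Σ-Monics-indicator mp d (φ d)) (if-cong refl (λ d≡e → cong φ (⌊⌋-true (d ≟ℕ e) d≡e))))

module Irreducibles (F : FiniteField) where
  open PolynomialRing F
  open MonicDivision F
  open Enumeration F

  splits? : ℕ → P → Bool
  splits? d p = any (λ i → ⌊ 1 ≤? i ⌋ ∧ any (λ a → any (λ b → (a ⊗ b) =? p) (Monics F (d ∸ i))) (Monics F i)) (upTo d)

  -- definitionally the test isIrreducible of Defs, applied to monic F v
  irreducible? : ℕ → P → Bool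
  irreducible? d p = ⌊ 1 ≤? d ⌋ ∧ not (splits? d p)

  -- a record wrapper, so that d and p can be inferred
  record Irreducible (d : ℕ) (p : P) : Set where
    constructor irreducibleₚ
    field passes : irreducible? d p ≡ true
  open Irreducible public

  Irreducible-deg : ∀ {d p} → Irreducible d p → 1 ≤ d
  Irreducible-deg {d} (irreducibleₚ e) = ⌊⌋-true (1 ≤? d) (proj₁ (∧-true e))

  record Factorisation (d : ℕ) (p : P) : Set where
    field
      i           : ℕ
      left right  : P
      1≤i         : 1 ≤ i
      i<d         : i < d
      left-monic  : Monic i left
      right-monic : Monic (d ∸ i) right
      left⊗right  : left ⊗ right ≡ p

  splits?-complete : ∀ {d p} → Factorisation d p → splits? d p ≡ true
  splits?-complete {d} {p} fac = any-intro _ _ i (∈-upTo⁺ i<d)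
    (trans (cong (⌊ 1 ≤? i ⌋ ∧_) (any-intro _ _ left (Monic⇒∈Monics left-monic)
                                   (any-intro _ _ right (Monic⇒∈Monics right-monic) (=?-≡ left⊗right))))
           (cong (_∧ true) (true-⌊⌋ (1 ≤? i) 1≤i)))
    where open Factorisation fac

  splits?-sound : ∀ {d p} → splits? d p ≡ true → Factorisation d p
  splits?-sound {d} {p} e =
    let (i , i∈ , test) = any-elim _ (upTo d) e
        (1≤i? , hasLeft) = ∧-true test
        (a , a∈ , hasRight) = any-elim _ (Monics F i) hasLeft
        (b , b∈ , ab=?p) = any-elim _ (Monics F (d ∸ i)) hasRight
    in record { i = i ; left = a ; right = b ; 1≤i = ⌊⌋-true (1 ≤? i) 1≤i? ; i<d = ∈-upTo⁻ i∈
              ; left-monic = ∈Monics⇒Monic a∈ ; right-monic = ∈Monics⇒Monic b∈ ; left⊗right = =?-sound _ _ ab=?p }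

  Irreducible-unsplit : ∀ {d p} → Irreducible d p → splits? d p ≡ false
  Irreducible-unsplit {d} {p} (irreducibleₚ e) with splits? d p | proj₂ (∧-true {⌊ 1 ≤? d ⌋} e)
  ... | false | _ = refl

  reducible-splits : ∀ {d p} → irreducible? d p ≡ false → 1 ≤ d → splits? d p ≡ true
  reducible-splits {d} {p} e 1≤d rewrite true-⌊⌋ (1 ≤? d) 1≤d with splits? d p | e
  ... | true | _ = refl

  irreducible-divisor-deg : ∀ {d p k m} → Monic d p → Irreducible d p → Monic k m → m ∣ p → k ≡ 0 ⊎ k ≡ d
  irreducible-divisor-deg {d} {p} {k} {m} mp irr mm m∣p with k ≟ℕ 0 | d ∸ k ≟ℕ 0
  ... | yes k≡0 | _         = inj₁ k≡0
  ... | no  _   | yes d∸k≡0 = inj₂ (≤-antisym (deg≤ mc) (m∸n≡0⇒m≤n d∸k≡0))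
    where mc = monicCofactor mp mm m∣p
  ... | no  k≢0 | no  d∸k≢0 = ⊥-elim (true≢false (trans (sym (splits?-complete fac)) (Irreducible-unsplit irr)))
    where
      mc = monicCofactor mp mm m∣p
      fac : Factorisation d p
      fac = record { i = k ; left = m ; right = cofactor mc ; 1≤i = n≢0⇒n>0 k≢0
                   ; i<d = ≤∧≢⇒< (deg≤ mc) (λ k≡d → d∸k≢0 (trans (cong (d ∸_) k≡d) (n∸n≡0 d)))
                   ; left-monic = mm ; right-monic = cofactor-monic mc ; left⊗right = sym (product mc) }

  irreducible-∣-≡ : ∀ {d e p Q} → Monic d p → Irreducible d p → Monic e Q → Irreducible e Q → Q ∣ p → Q ≡ p
  irreducible-∣-≡ {d} {e} {p} {Q} mp ip mQ iQ Q∣p with irreducible-divisor-deg mp ip mQ Q∣p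
  ... | inj₁ refl = ⊥-elim (<⇒≱ (Irreducible-deg {0} iQ) z≤n)
  ... | inj₂ refl = sym (Monic-≈ mp mQ (≈-trans (≡⇒≈ (product mc))
                          (≈-trans (⊗-congʳ Q (≡⇒≈ (Monic-0 (subst (λ j → Monic j (cofactor mc)) (n∸n≡0 e) (cofactor-monic mc)))))
                            (⊗-identityʳ Q))))
    where mc = monicCofactor mp mQ Q∣p

  module Euclid {d p} (mp : Monic d p) (irr : Irreducible d p) where

    -- By descent on n:
    -- normalise x to a monic m of degree k < n and divide p by m.  A zero remainder makes
    -- m a divisor of p, hence m = 1; otherwise the remainder is a smaller such x.
    descent : ∀ n b x → n ≤ d → DegBelow n x → ¬ (x ≈ []) → p ∣ x ⊗ b → p ∣ b
    monic-descent : ∀ n b {k m} → suc n ≤ d → Monic k m → k ≤ n → p ∣ m ⊗ b → p ∣ b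

    descent zero    b x _   x<0 x≢0 _   = ⊥-elim (x≢0 (DegBelow-0 x<0))
    descent (suc n) b x n<d x<n x≢0 p∣xb with trim x | trim≈ x | trim-Trimmed x
    ... | []    | t≈x | zeroₜ      = ⊥-elim (x≢0 (≈-sym t≈x))
    ... | y ∷ s | t≈x | topₜ top≢0 = monic-descent n b n<d mm k≤n p∣mb
      where
        k = length s
        u = proj₁ (normalise y s top≢0)
        mm = proj₂ (normalise y s top≢0)
        k≤n : k ≤ n
        k≤n = ≤-pred (≰⇒> (λ le → top≢0 (trans (at t≈x k) (vanish x<n k le))))
        p∣mb : p ∣ sc u (y ∷ s) ⊗ b
        p∣mb = ∣-resp-≈ (∣-sc u p∣xb) (≈-sym (≈-trans (⊗-scˡ u (y ∷ s) b) (sc-cong (⊗-congˡ b t≈x))))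

    monic-descent n b {k} {m} n<d mm k≤n p∣mb with isZero (rem m p) in r≟0
    ... | true  = from-divisor (irreducible-divisor-deg mp irr mm (divides?-sound mm p r≟0))
      where
        from-divisor : k ≡ 0 ⊎ k ≡ d → p ∣ b
        from-divisor (inj₁ refl) = ∣-resp-≈ p∣mb (≈-trans (⊗-congˡ b (≡⇒≈ (Monic-0 mm))) (⊗-identityˡ b))
        from-divisor (inj₂ k≡d)  = ⊥-elim (<⇒≱ (s≤s k≤n) (≤-trans n<d (≤-reflexive (sym k≡d))))
    ... | false = descent n b r (≤-trans (n≤1+n n) n<d) (DegBelow-mono k≤n (remainder spec)) r≢0 p∣rb
      where
        spec = divmod-spec mm p
        t = quo m p
        r = rem m p
        r≢0 : ¬ (r ≈ [])
        r≢0 r≈0 = true≢false (trans (sym (isZero-complete r r≈0)) r≟0)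
        -- r b = p b − (m b) t
        p∣rb : p ∣ r ⊗ b
        p∣rb = ∣-resp-≈ (∣-⊕ (∣-refl⊗ p b) (∣-neg (∣-resp-≈ (∣-⊗ʳ p∣mb t) mbt≈mtb)))
                 (≈-sym (≈-trans (⊗-congˡ b (isolate (division spec)))
                   (≈-trans (⊗-distribʳ p (neg (m ⊗ t)) b) (⊕-cong (≈-refl {p ⊗ b}) (⊗-negˡ (m ⊗ t) b)))))
          where
            mbt≈mtb : (m ⊗ b) ⊗ t ≈ (m ⊗ t) ⊗ b
            mbt≈mtb = ≈-trans (⊗-assoc m b t) (≈-trans (⊗-congʳ m (⊗-comm b t)) (≈-sym (⊗-assoc m t b)))

    euclid : ∀ a b → p ∣ a ⊗ b → p ∣ a ⊎ p ∣ b
    euclid a b p∣ab with isZero (rem p a) in r≟0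
    ... | true  = inj₁ (divides?-sound mp a r≟0)
    ... | false = inj₂ (descent d b r ≤-refl (remainder spec) r≢0 p∣rb)
      where
        spec = divmod-spec mp a
        r = rem p a
        t = quo p a
        r≢0 : ¬ (r ≈ [])
        r≢0 r≈0 = true≢false (trans (sym (isZero-complete r r≈0)) r≟0)
        -- r b = a b − p (t b)
        p∣rb : p ∣ r ⊗ b
        p∣rb = ∣-resp-≈ (∣-⊕ p∣ab (∣-neg (∣-resp-≈ (∣-refl⊗ p (t ⊗ b)) (≈-sym (⊗-assoc p t b)))))
                 (≈-sym (≈-trans (⊗-congˡ b (isolate (division spec)))
                   (≈-trans (⊗-distribʳ a (neg (p ⊗ t)) b) (⊕-cong (≈-refl {a ⊗ b}) (⊗-negˡ (p ⊗ t) b)))))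

  open Euclid public using (euclid)

  pow : P → ℕ → P
  pow = powP F

  Monic-pow : ∀ {d p} → Monic d p → ∀ k → Monic (d * k) (pow p k)
  Monic-pow {d} mp zero    = subst (λ j → Monic j one) (sym (*-zeroʳ d)) Monic-one
  Monic-pow {d} {p} mp (suc k) = subst (λ j → Monic j (pow p (suc k))) (sym (*-suc d k)) (Monic-⊗ mp (Monic-pow mp k))

  coprime-pow : ∀ {d e p Q} → Monic d p → Irreducible d p → Monic e Q → Irreducible e Q → Q ≢ p →
                ∀ k g → pow Q k ∣ p ⊗ g → pow Q k ∣ g
  coprime-pow mp ip mQ iQ Q≢p zero    g _ = one∣ g
  coprime-pow {p = p} {Q} mp ip mQ iQ Q≢p (suc k) g Q^k+1∣pg
    with euclid mQ iQ p g (∣-trans (∣-refl⊗ Q (pow Q k)) Q^k+1∣pg)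
  ... | inj₁ Q∣p         = ⊥-elim (Q≢p (irreducible-∣-≡ mp ip mQ iQ Q∣p))
  ... | inj₂ (g' , g≈Qg') = ∣-resp-≈ (∣-⊗-both Q Q^k∣g') (≈-sym g≈Qg')
    where
      pg≈Q[pg'] : p ⊗ g ≈ Q ⊗ (p ⊗ g')
      pg≈Q[pg'] = ≈-trans (⊗-congʳ p g≈Qg') (≈-trans (≈-sym (⊗-assoc p Q g'))
                    (≈-trans (⊗-congˡ g' (⊗-comm p Q)) (⊗-assoc Q p g')))
      Q^k∣g' : pow Q k ∣ g'
      Q^k∣g' = coprime-pow mp ip mQ iQ Q≢p k g' (∣-cancelˡ mQ (∣-resp-≈ Q^k+1∣pg pg≈Q[pg']))

  record IrreducibleFactor (n : ℕ) (f : P) : Set where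
    field
      deg                : ℕ
      factor rest        : P
      factor-irreducible : Irreducible deg factor
      factor-monic       : Monic deg factor
      rest-monic         : Monic (n ∸ deg) rest
      deg≤n              : deg ≤ n
      factor⊗rest        : f ≡ factor ⊗ rest

  irreducibleFactor : ∀ n f → Monic n f → 1 ≤ n → IrreducibleFactor n f
  irreducibleFactor n f = bounded n n f ≤-refl
    where
      -- recursion on a bound B ≥ n: a reducible f splits into factors of smaller degree
      bounded : ∀ B n f → n ≤ B → Monic n f → 1 ≤ n → IrreducibleFactor n f
      bounded B n f n≤B mf 1≤n with irreducible? n f in irr
      ... | true = record { deg = n ; factor = f ; rest = one ; factor-irreducible = irreducibleₚ irr ; factor-monic = mf
                          ; rest-monic = subst (λ j → Monic j one) (sym (n∸n≡0 n)) Monic-one ; deg≤n = ≤-refl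
                          ; factor⊗rest = sym (Monic-≈ (Monic-⊗ mf Monic-one) mf (⊗-identityʳ f)) }
      bounded zero    n f n≤B mf 1≤n | false = ⊥-elim (<⇒≱ 1≤n n≤B)
      bounded (suc B) n f n≤B mf 1≤n | false = record
        { deg = deg ; factor = factor ; rest = rest ⊗ right ; factor-irreducible = factor-irreducible
        ; factor-monic = factor-monic ; rest-monic = rest⊗right-monic ; deg≤n = ≤-trans deg≤n (<⇒≤ i<d)
        ; factor⊗rest = sym (Monic-≈ (Monic-⊗ factor-monic rest⊗right-monic) mf
                          (≈-trans (≈-sym (⊗-assoc factor rest right)) (≈-trans (⊗-congˡ right (≡⇒≈ (sym factor⊗rest))) (≡⇒≈ left⊗right)))) }
        where
          open Factorisation (splits?-sound {n} {f} (reducible-splits {n} {f} irr 1≤n))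
          open IrreducibleFactor (bounded B i left (≤-pred (≤-trans i<d n≤B)) left-monic 1≤i)
          degrees : (i ∸ deg) + (n ∸ i) ≡ n ∸ deg
          degrees = trans (sym (+-∸-comm (n ∸ i) deg≤n)) (cong (_∸ deg) (m+[n∸m]≡n (<⇒≤ i<d)))
          rest⊗right-monic : Monic (n ∸ deg) (rest ⊗ right)
          rest⊗right-monic = subst (λ j → Monic j (rest ⊗ right)) degrees (Monic-⊗ rest-monic right-monic)

-- Sums over candidate prime powers P^k, where P = monic v runs over all monic
-- polynomials of degree d ≤ B and 0 ≤ k ≤ B.
module PrimePowerSums (F : FiniteField) where
  open PolynomialRing F

  ΣPowers : ℕ → ((d : ℕ) → Vec Carrier d → ℕ → ℕ) → ℕ
  ΣPowers B X = Σl (upTo (suc B)) (λ d → Σl (allVecs F d) (λ v → Σl (upTo (suc B)) (X d v)))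

  ΣPowers-cong : ∀ B {X Y : (d : ℕ) → Vec Carrier d → ℕ → ℕ} → (∀ d v k → X d v k ≡ Y d v k) → ΣPowers B X ≡ ΣPowers B Y
  ΣPowers-cong B e = Σ-cong (upTo (suc B)) (λ d → Σ-cong (allVecs F d) (λ v → Σ-cong (upTo (suc B)) (e d v)))

  ΣPowers-+ : ∀ B (X Y : (d : ℕ) → Vec Carrier d → ℕ → ℕ) → ΣPowers B (λ d v k → X d v k + Y d v k) ≡ ΣPowers B X + ΣPowers B Y
  ΣPowers-+ B X Y = trans (Σ-cong (upTo (suc B)) (λ d → trans (Σ-cong (allVecs F d) (λ v → Σ-+ (upTo (suc B)) (X d v) (Y d v)))
                      (Σ-+ (allVecs F d) (λ v → Σl (upTo (suc B)) (X d v)) (λ v → Σl (upTo (suc B)) (Y d v)))))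
                     (Σ-+ (upTo (suc B)) (λ d → Σl (allVecs F d) (λ v → Σl (upTo (suc B)) (X d v)))
                                         (λ d → Σl (allVecs F d) (λ v → Σl (upTo (suc B)) (Y d v))))

  ΣPowers-*ˡ : ∀ B c (X : (d : ℕ) → Vec Carrier d → ℕ → ℕ) → ΣPowers B (λ d v k → c * X d v k) ≡ c * ΣPowers B X
  ΣPowers-*ˡ B c X = trans (Σ-cong (upTo (suc B)) (λ d → trans (Σ-cong (allVecs F d) (λ v → Σ-*ˡ (upTo (suc B)) c (X d v)))
                       (Σ-*ˡ (allVecs F d) c (λ v → Σl (upTo (suc B)) (X d v)))))
                      (Σ-*ˡ (upTo (suc B)) c (λ d → Σl (allVecs F d) (λ v → Σl (upTo (suc B)) (X d v))))

  Σ-ΣPowers : ∀ {A : Set} (xs : List A) B (X : A → (d : ℕ) → Vec Carrier d → ℕ → ℕ) →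
              Σl xs (λ x → ΣPowers B (X x)) ≡ ΣPowers B (λ d v k → Σl xs (λ x → X x d v k))
  Σ-ΣPowers xs B X = trans (Σ-swap xs (upTo (suc B)) _) (Σ-cong (upTo (suc B)) λ d →
    trans (Σ-swap xs (allVecs F d) _) (Σ-cong (allVecs F d) λ v → Σ-swap xs (upTo (suc B)) _))

  ΣPowers-zero : ∀ B → ΣPowers B (λ _ _ _ → 0) ≡ 0
  ΣPowers-zero B = trans (Σ-cong (upTo (suc B)) (λ d → trans (Σ-cong (allVecs F d) (λ v → Σ-zero (upTo (suc B))))
                                                          (Σ-zero (allVecs F d))))
                         (Σ-zero (upTo (suc B)))

  ΣPowers-if : ∀ B b (X : (d : ℕ) → Vec Carrier d → ℕ → ℕ) →
               ΣPowers B (λ d v k → if b then X d v k else 0) ≡ (if b then ΣPowers B X else 0)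
  ΣPowers-if B true  X = refl
  ΣPowers-if B false X = ΣPowers-zero B

-- The divisor-sum identity  Σ_{D ∣ f} Λ(D) = deg f  for monic f, proved by induction
-- along f = p g with p monic irreducible: passing from g to p g adds exactly one
-- prime-power divisor p^k for each k, and none for other primes (Euclid's lemma).
module DivisorSum (F : FiniteField) where
  open PolynomialRing F
  open MonicDivision F
  open Enumeration F
  open Irreducibles F
  open PrimePowerSums F

  -- the term of Σ_{D ∣ f} Λ(D) at D = P^k, P = monic v
  ΛDiv : (d : ℕ) → Vec Carrier d → ℕ → P → ℕ
  ΛDiv d v k f = if irreducible? d (monic F v) ∧ ⌊ 1 ≤? k ⌋ ∧ divides? (pow (monic F v) k) f then d else 0

  powerSum : ℕ → ℕ → P → P → ℕ
  powerSum B d P f = Σl (upTo (suc B)) (λ k → if ⌊ 1 ≤? k ⌋ ∧ divides? (pow P k) f then d else 0)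

  divides?-pow-coprime : ∀ {d e p Q} → Monic d p → Irreducible d p → Monic e Q → Irreducible e Q → Q ≢ p →
                         ∀ k g → divides? (pow Q k) (p ⊗ g) ≡ divides? (pow Q k) g
  divides?-pow-coprime {p = p} mp ip mQ iQ Q≢p k g = bool-ext
    (λ t → divides?-complete (Monic-pow mQ k) g (coprime-pow mp ip mQ iQ Q≢p k g (divides?-sound (Monic-pow mQ k) (p ⊗ g) t)))
    (λ t → divides?-complete (Monic-pow mQ k) (p ⊗ g) (∣-⊗ˡ p (divides?-sound (Monic-pow mQ k) g t)))

  divides?-pow-self : ∀ {d p} → Monic d p → ∀ k g → divides? (pow p (suc k)) (p ⊗ g) ≡ divides? (pow p k) g
  divides?-pow-self {p = p} mp k g = bool-ext
    (λ t → divides?-complete (Monic-pow mp k) g (∣-cancelˡ mp (divides?-sound (Monic-pow mp (suc k)) (p ⊗ g) t)))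
    (λ t → divides?-complete (Monic-pow mp (suc k)) (p ⊗ g) (∣-⊗-both p (divides?-sound (Monic-pow mp k) g t)))

  -- p^k ∣ p g  ⟺  p^{k−1} ∣ g,  and p^B ∤ g by degree; so the k-sum grows by one term.
  powerSum-self : ∀ B {d p m g} → Monic d p → Monic m g → 1 ≤ d → d + m ≤ B →
                  powerSum B d p (p ⊗ g) ≡ powerSum B d p g + d
  powerSum-self zero     {d} {m = m} mp mg 1≤d d+m≤B = ⊥-elim (<⇒≱ (≤-trans 1≤d (m≤m+n d m)) d+m≤B)
  powerSum-self (suc B') {d} {p} {m} {g} mp mg 1≤d d+m≤B = begin
    powerSum (suc B') d p (p ⊗ g)            ≡⟨ Σ-upTo-first (suc B') (λ k → if ⌊ 1 ≤? k ⌋ ∧ divides? (pow p k) (p ⊗ g) then d else 0) ⟩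
    Σl (upTo (suc B')) (λ k → if divides? (pow p (suc k)) (p ⊗ g) then d else 0)
                                             ≡⟨ Σ-cong (upTo (suc B')) (λ k → cong (λ b → if b then d else 0) (divides?-pow-self mp k g)) ⟩
    Σl (upTo (suc B')) c                     ≡⟨ Σ-upTo-first B' c ⟩
    c 0 + Σl (upTo B') (c ∘ suc)             ≡⟨ cong (_+ Σl (upTo B') (c ∘ suc)) c0≡d ⟩
    d + Σl (upTo B') (c ∘ suc)               ≡⟨ +-comm d _ ⟩
    Σl (upTo B') (c ∘ suc) + d               ≡⟨ cong (_+ d) (trans (sym (+-identityʳ _)) (cong (Σl (upTo B') (c ∘ suc) +_) (sym cB≡0))) ⟩
    (Σl (upTo B') (c ∘ suc) + c (suc B')) + d ≡⟨ cong (_+ d) (sym (Σ-upTo-last B' (c ∘ suc))) ⟩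
    Σl (upTo (suc B')) (c ∘ suc) + d         ≡⟨ cong (_+ d) (sym (Σ-upTo-first (suc B') (λ k → if ⌊ 1 ≤? k ⌋ ∧ divides? (pow p k) g then d else 0))) ⟩
    powerSum (suc B') d p g + d              ∎
    where
      open ≡-Reasoning
      c : ℕ → ℕ
      c k = if divides? (pow p k) g then d else 0
      c0≡d : c 0 ≡ d
      c0≡d = cong (λ b → if b then d else 0) (divides?-complete Monic-one g (one∣ g))
      cB≡0 : c (suc B') ≡ 0
      cB≡0 with divides? (pow p (suc B')) g in e
      ... | false = refl
      ... | true  = ⊥-elim (<⇒≱ m<d·B (∣-deg (Monic-pow mp (suc B')) mg (divides?-sound (Monic-pow mp (suc B')) g e)))
        where
          m<d·B : m < d * suc B'
          m<d·B = ≤-trans (≤-trans (+-monoˡ-≤ m 1≤d) d+m≤B) (m≤n*m (suc B') d {{≢-nonZero (λ d≡0 → <⇒≱ 1≤d (≤-reflexive d≡0))}})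

  ΛDiv-step : ∀ B {e p m g} → Monic e p → Irreducible e p → Monic m g → e + m ≤ B → ∀ d v →
              Σl (upTo (suc B)) (λ k → ΛDiv d v k (p ⊗ g))
                ≡ Σl (upTo (suc B)) (λ k → ΛDiv d v k g) + (if monic F v =? p then d else 0)
  ΛDiv-step B {e} {p} {m} {g} mp ip mg e+m≤B d v with irreducible? d (monic F v) in irr | monic F v =? p in v=?p
  ... | false | false = trans (Σ-zero (upTo (suc B))) (sym (trans (+-identityʳ _) (Σ-zero (upTo (suc B)))))
  ... | false | true  = ⊥-elim (true≢false (trans (sym (passes irr-v)) irr))
    where
      irr-v : Irreducible d (monic F v)
      irr-v with =?-sound _ _ v=?p
      ... | refl with Monic-deg-unique mp (monic-Monic v)
      ...   | refl = ip
  ... | true  | false = trans (Σ-cong (upTo (suc B)) (λ k → cong (λ b → if ⌊ 1 ≤? k ⌋ ∧ b then d else 0)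
                                (divides?-pow-coprime mp ip (monic-Monic v) (irreducibleₚ irr) v≢p k g)))
                              (sym (+-identityʳ _))
    where
      v≢p : monic F v ≢ p
      v≢p v≡p = true≢false (trans (sym (=?-≡ v≡p)) v=?p)
  ... | true  | true with =?-sound _ _ v=?p
  ...   | refl with Monic-deg-unique mp (monic-Monic v)
  ...     | refl = powerSum-self B mp mg (Irreducible-deg ip) e+m≤B

  ΛDiv-one : ∀ d v k → ΛDiv d v k one ≡ 0
  ΛDiv-one d v k with irreducible? d (monic F v) in irr | 1 ≤? k | divides? (pow (monic F v) k) one in P^k∣1
  ... | false | _       | _     = refl
  ... | true  | no _    | _     = refl
  ... | true  | yes _   | false = refl
  ... | true  | yes 1≤k | true  = ⊥-elim (<⇒≱ (*-mono-≤ (Irreducible-deg {d} {monic F v} (irreducibleₚ irr)) 1≤k)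
                                     (∣-deg (Monic-pow (monic-Monic v) k) Monic-one (divides?-sound (Monic-pow (monic-Monic v) k) one P^k∣1)))

  divisorSum : ∀ B {m f} → Monic m f → m ≤ B → ΣPowers B (λ d v k → ΛDiv d v k f) ≡ m
  divisorSum B {m} mf m≤B = bounded m mf ≤-refl m≤B
    where
      bounded : ∀ C {m f} → Monic m f → m ≤ C → m ≤ B → ΣPowers B (λ d v k → ΛDiv d v k f) ≡ m
      bounded C {zero} mf _ _ rewrite Monic-0 mf =
        trans (ΣPowers-cong B ΛDiv-one) (ΣPowers-zero B)
      bounded zero    {suc m}     mf () _
      bounded (suc C) {suc m} {f} mf m≤C m≤B = begin
        ΣPowers B (λ d v k → ΛDiv d v k f)
          ≡⟨ cong (λ h → ΣPowers B (λ d v k → ΛDiv d v k h)) factor⊗rest ⟩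
        ΣPowers B (λ d v k → ΛDiv d v k (factor ⊗ rest))
          ≡⟨ Σ-cong (upTo (suc B)) (λ d → Σ-cong (allVecs F d)
               (ΛDiv-step B factor-monic factor-irreducible rest-monic (subst (_≤ B) (sym (m+[n∸m]≡n deg≤n)) m≤B) d)) ⟩
        Σl (upTo (suc B)) (λ d → Σl (allVecs F d) (λ v → Σl (upTo (suc B)) (λ k → ΛDiv d v k rest) + (if monic F v =? factor then d else 0)))
          ≡⟨ Σ-cong (upTo (suc B)) (λ d → Σ-+ (allVecs F d) (λ v → Σl (upTo (suc B)) (λ k → ΛDiv d v k rest)) (λ v → if monic F v =? factor then d else 0)) ⟩
        Σl (upTo (suc B)) (λ d → Σl (allVecs F d) (λ v → Σl (upTo (suc B)) (λ k → ΛDiv d v k rest)) + Σl (allVecs F d) (λ v → if monic F v =? factor then d else 0))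
          ≡⟨ Σ-+ (upTo (suc B)) (λ d → Σl (allVecs F d) (λ v → Σl (upTo (suc B)) (λ k → ΛDiv d v k rest)))
                                 (λ d → Σl (allVecs F d) (λ v → if monic F v =? factor then d else 0)) ⟩
        ΣPowers B (λ d v k → ΛDiv d v k rest) + Σl (upTo (suc B)) (λ d → Σl (allVecs F d) (λ v → if monic F v =? factor then d else 0))
          ≡⟨ cong₂ _+_ (bounded C rest-monic (≤-trans (∸-monoʳ-≤ (suc m) 1≤deg) (≤-pred m≤C)) (≤-trans (m∸n≤m (suc m) deg) m≤B))
                       (Σ-allMonics-indicator B factor-monic (≤-trans deg≤n m≤B) (λ d → d)) ⟩
        (suc m ∸ deg) + deg
          ≡⟨ m∸n+n≡m deg≤n ⟩
        suc m ∎
        where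
          open ≡-Reasoning
          open IrreducibleFactor (irreducibleFactor (suc m) f mf (s≤s z≤n))
          1≤deg : 1 ≤ deg
          1≤deg = Irreducible-deg factor-irreducible

-- The prime polynomial theorem  Σ_{f ∈ M_m} Λ(f) = q^m, in the form
--   Σ_{P irreducible, k ≥ 1, k deg P = m} deg P = q^m.
module PrimePolynomialTheorem (F : FiniteField) where
  open PolynomialRing F
  open MonicDivision F
  open Enumeration F
  open Irreducibles F
  open PrimePowerSums F
  open DivisorSum F

  -- the number of monic polynomials of degree m divisible by a given monic of degree j
  multiples : ℕ → ℕ → ℕ
  multiples j m = if ⌊ j ≤? m ⌋ then q ^ (m ∸ j) else 0

  -- [Q ∣ f] = #{h ∈ M_{m−e} : Q h = f} for monic f of degree m: the cofactor is unique.
  divides-as-count : ∀ {e Q m f} → Monic e Q → Monic m f →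
                     (if divides? Q f then 1 else 0) ≡ Σl (Monics F (m ∸ e)) (λ h → if (Q ⊗ h) =? f then 1 else 0)
  divides-as-count {e} {Q} {m} {f} mQ mf with divides? Q f in Q∣f?
  ... | true = sym (trans (Σ-cong∈ (Monics F (m ∸ e)) (λ h h∈ → if-cong (bool-ext (to (∈Monics⇒Monic h∈)) from) (λ _ → refl)))
                          (trans (Σ-Monics-indicator (cofactor-monic mc) (m ∸ e) 1) (if-cong (true-⌊⌋ (m ∸ e ≟ℕ m ∸ e) refl) (λ _ → refl))))
    where
      mc = monicCofactor mf mQ (divides?-sound mQ f Q∣f?)
      to : ∀ {h} → Monic (m ∸ e) h → (Q ⊗ h) =? f ≡ true → h =? cofactor mc ≡ true
      to {h} mh Qh=f = =?-≡ (Monic-≈ mh (cofactor-monic mc)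
                         (⊗-cancelˡ mQ h (cofactor mc) (≡⇒≈ (trans (=?-sound _ _ Qh=f) (product mc)))))
      from : ∀ {h} → h =? cofactor mc ≡ true → (Q ⊗ h) =? f ≡ true
      from {h} e = =?-≡ (trans (cong (Q ⊗_) (=?-sound _ _ e)) (sym (product mc)))
  ... | false = sym (trans (Σ-cong (Monics F (m ∸ e)) none) (Σ-zero (Monics F (m ∸ e))))
    where
      none : ∀ h → (if (Q ⊗ h) =? f then 1 else 0) ≡ 0
      none h with (Q ⊗ h) =? f in Qh=f
      ... | false = refl
      ... | true  = ⊥-elim (true≢false (trans (sym (divides?-complete mQ f (h , ≡⇒≈ (sym (=?-sound _ _ Qh=f))))) Q∣f?))

  product-count : ∀ {e Q} m {h} → Monic e Q → Monic (m ∸ e) h →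
                  Σl (Monics F m) (λ f → if (Q ⊗ h) =? f then 1 else 0) ≡ (if ⌊ e ≤? m ⌋ then 1 else 0)
  product-count {e} {Q} m {h} mQ mh =
    trans (Σ-cong (Monics F m) (λ f → cong (λ b → if b then 1 else 0) (=?-sym (Q ⊗ h) f)))
          (trans (Σ-Monics-indicator (Monic-⊗ mQ mh) m 1) (if-cong (bool-ext to from) (λ _ → refl)))
    where
      to : ⌊ m ≟ℕ e + (m ∸ e) ⌋ ≡ true → ⌊ e ≤? m ⌋ ≡ true
      to t = true-⌊⌋ (e ≤? m) (subst (e ≤_) (sym (⌊⌋-true (m ≟ℕ _) t)) (m≤m+n e (m ∸ e)))
      from : ⌊ e ≤? m ⌋ ≡ true → ⌊ m ≟ℕ e + (m ∸ e) ⌋ ≡ true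
      from t = true-⌊⌋ (m ≟ℕ _) (sym (m+[n∸m]≡n (⌊⌋-true (e ≤? m) t)))

  -- A monic Q of degree e divides exactly q^{m − e} monics of degree m ≥ e:
  -- h ↦ Q h is a bijection from M_{m−e} onto them.
  count-multiples : ∀ {e Q} → Monic e Q → ∀ m → Σl (Monics F m) (λ f → if divides? Q f then 1 else 0) ≡ multiples e m
  count-multiples {e} {Q} mQ m = begin
    Σl (Monics F m) (λ f → if divides? Q f then 1 else 0)
      ≡⟨ Σ-cong∈ (Monics F m) (λ f f∈ → divides-as-count mQ (∈Monics⇒Monic f∈)) ⟩
    Σl (Monics F m) (λ f → Σl (Monics F (m ∸ e)) (λ h → if (Q ⊗ h) =? f then 1 else 0))
      ≡⟨ Σ-swap (Monics F m) (Monics F (m ∸ e)) _ ⟩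
    Σl (Monics F (m ∸ e)) (λ h → Σl (Monics F m) (λ f → if (Q ⊗ h) =? f then 1 else 0))
      ≡⟨ Σ-cong∈ (Monics F (m ∸ e)) (λ h h∈ → product-count m mQ (∈Monics⇒Monic h∈)) ⟩
    Σl (Monics F (m ∸ e)) (λ _ → if ⌊ e ≤? m ⌋ then 1 else 0)
      ≡⟨ Σ-const (Monics F (m ∸ e)) _ ⟩
    (if ⌊ e ≤? m ⌋ then 1 else 0) * length (Monics F (m ∸ e))
      ≡⟨ cong ((if ⌊ e ≤? m ⌋ then 1 else 0) *_) (length-Monics (m ∸ e)) ⟩
    (if ⌊ e ≤? m ⌋ then 1 else 0) * q ^ (m ∸ e)
      ≡⟨ indicator-* ⌊ e ≤? m ⌋ ⟩
    multiples e m ∎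
    where
      open ≡-Reasoning
      indicator-* : ∀ b → (if b then 1 else 0) * q ^ (m ∸ e) ≡ (if b then q ^ (m ∸ e) else 0)
      indicator-* true  = +-identityʳ _
      indicator-* false = refl

  -- Λweighted m P^k = deg P · #{f ∈ M_m : P^k ∣ f} for irreducible P and k ≥ 1
  Λweighted : ℕ → (d : ℕ) → Vec Carrier d → ℕ → ℕ
  Λweighted m d v k = if irreducible? d (monic F v) ∧ ⌊ 1 ≤? k ⌋ then d * multiples (d * k) m else 0

  -- Summing Σ_{D ∣ f} Λ(D) = m over f ∈ M_m and interchanging the sums:
  --   m q^m = Σ_{P^k} deg P · #{f ∈ M_m : P^k ∣ f}.
  degree-weighted-count : ∀ B m → m ≤ B → m * q ^ m ≡ ΣPowers B (Λweighted m)
  degree-weighted-count B m m≤B = begin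
    m * q ^ m                                                   ≡⟨ cong (m *_) (length-Monics m) ⟨
    m * length (Monics F m)                                     ≡⟨ Σ-const (Monics F m) m ⟨
    Σl (Monics F m) (λ _ → m)                                   ≡⟨ Σ-cong∈ (Monics F m) (λ f f∈ → sym (divisorSum B (∈Monics⇒Monic f∈) m≤B)) ⟩
    Σl (Monics F m) (λ f → ΣPowers B (λ d v k → ΛDiv d v k f))  ≡⟨ Σ-ΣPowers (Monics F m) B (λ f d v k → ΛDiv d v k f) ⟩
    ΣPowers B (λ d v k → Σl (Monics F m) (ΛDiv d v k))          ≡⟨ ΣPowers-cong B count ⟩
    ΣPowers B (Λweighted m)                                     ∎
    where
      open ≡-Reasoning
      count : ∀ d v k → Σl (Monics F m) (ΛDiv d v k) ≡ Λweighted m d v k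
      count d v k = begin
        Σl (Monics F m) (ΛDiv d v k)
          ≡⟨ Σ-cong (Monics F m) (λ f → if-∧∧ (irreducible? d (monic F v)) ⌊ 1 ≤? k ⌋ _ d) ⟩
        Σl (Monics F m) (λ f → if irreducible? d (monic F v) ∧ ⌊ 1 ≤? k ⌋ then (if divides? (pow (monic F v) k) f then d else 0) else 0)
          ≡⟨ Σ-if (Monics F m) _ _ ⟩
        (if irreducible? d (monic F v) ∧ ⌊ 1 ≤? k ⌋ then Σl (Monics F m) (λ f → if divides? (pow (monic F v) k) f then d else 0) else 0)
          ≡⟨ if-cong refl (λ _ → trans (Σ-cong (Monics F m) (λ f → scale (divides? (pow (monic F v) k) f)))
                                  (trans (Σ-*ˡ (Monics F m) d _) (cong (d *_) (count-multiples (Monic-pow (monic-Monic v) k) m)))) ⟩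
        Λweighted m d v k ∎
        where
          scale : ∀ b → (if b then d else 0) ≡ d * (if b then 1 else 0)
          scale true  = sym (*-identityʳ d)
          scale false = sym (*-zeroʳ d)

  Λexact : ℕ → (d : ℕ) → Vec Carrier d → ℕ → ℕ
  Λexact m d v k = if irreducible? d (monic F v) ∧ ⌊ 1 ≤? k ⌋ ∧ ⌊ d * k ≟ℕ m ⌋ then d else 0

  multiples-suc : ∀ j m → multiples j (suc m) ≡ (if ⌊ j ≟ℕ suc m ⌋ then 1 else 0) + q * multiples j m
  multiples-suc j m with j ≤? m | j ≤? suc m | j ≟ℕ suc m
  ... | yes j≤m | _        | yes refl   = ⊥-elim (<⇒≱ (n<1+n m) j≤m)
  ... | yes j≤m | yes _    | no _       = cong (q ^_) (+-∸-assoc 1 j≤m)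
  ... | yes j≤m | no j≰sm  | _          = ⊥-elim (j≰sm (m≤n⇒m≤1+n j≤m))
  ... | no _    | yes _    | yes refl   = trans (cong (q ^_) (n∸n≡0 (suc m))) (cong suc (sym (*-zeroʳ q)))
  ... | no j≰m  | yes j≤sm | no j≢sm    = ⊥-elim (j≢sm (≤-antisym j≤sm (≰⇒> j≰m)))
  ... | no _    | no j≰sm  | yes refl   = ⊥-elim (j≰sm ≤-refl)
  ... | no _    | no _     | no _       = sym (*-zeroʳ q)

  Λweighted-suc : ∀ m d v k → Λweighted (suc m) d v k ≡ Λexact (suc m) d v k + q * Λweighted m d v k
  Λweighted-suc m d v k with irreducible? d (monic F v) | ⌊ 1 ≤? k ⌋
  ... | false | _     = sym (*-zeroʳ q)
  ... | true  | false = sym (*-zeroʳ q)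
  ... | true  | true  = begin
    d * multiples (d * k) (suc m)                                         ≡⟨ cong (d *_) (multiples-suc (d * k) m) ⟩
    d * ((if ⌊ d * k ≟ℕ suc m ⌋ then 1 else 0) + q * multiples (d * k) m) ≡⟨ *-distribˡ-+ d _ _ ⟩
    d * (if ⌊ d * k ≟ℕ suc m ⌋ then 1 else 0) + d * (q * multiples (d * k) m)
      ≡⟨ cong₂ _+_ (scale ⌊ d * k ≟ℕ suc m ⌋) (trans (sym (*-assoc d q _)) (trans (cong (_* multiples (d * k) m) (*-comm d q)) (*-assoc q d _))) ⟩
    (if ⌊ d * k ≟ℕ suc m ⌋ then d else 0) + q * (d * multiples (d * k) m) ∎
    where
      open ≡-Reasoning
      scale : ∀ b → d * (if b then 1 else 0) ≡ (if b then d else 0)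
      scale true  = *-identityʳ d
      scale false = *-zeroʳ d

  -- Subtracting q times the identity for m from the one for m + 1 leaves
  --   (m + 1) q^{m+1} − q · m q^m = q^{m+1}.
  primePolynomialTheorem : ∀ B m → 1 ≤ m → m ≤ B → ΣPowers B (Λexact m) ≡ q ^ m
  primePolynomialTheorem B (suc m) _ sm≤B = +-cancelʳ-≡ (m * q ^ suc m) _ _ (sym (begin
    q ^ suc m + m * q ^ suc m                                     ≡⟨⟩
    suc m * q ^ suc m                                             ≡⟨ degree-weighted-count B (suc m) sm≤B ⟩
    ΣPowers B (Λweighted (suc m))                                 ≡⟨ ΣPowers-cong B (Λweighted-suc m) ⟩
    ΣPowers B (λ d v k → Λexact (suc m) d v k + q * Λweighted m d v k)
                                                                  ≡⟨ ΣPowers-+ B (Λexact (suc m)) _ ⟩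
    ΣPowers B (Λexact (suc m)) + ΣPowers B (λ d v k → q * Λweighted m d v k)
                                                                  ≡⟨ cong (ΣPowers B (Λexact (suc m)) +_) (ΣPowers-*ˡ B q (Λweighted m)) ⟩
    ΣPowers B (Λexact (suc m)) + q * ΣPowers B (Λweighted m)      ≡⟨ cong (λ z → ΣPowers B (Λexact (suc m)) + q * z)
                                                                       (degree-weighted-count B m (≤-trans (n≤1+n m) sm≤B)) ⟨
    ΣPowers B (Λexact (suc m)) + q * (m * q ^ m)                  ≡⟨ cong (ΣPowers B (Λexact (suc m)) +_)
                                                                       (trans (sym (*-assoc q m _)) (trans (cong (_* q ^ m) (*-comm q m)) (*-assoc m q _))) ⟩
    ΣPowers B (Λexact (suc m)) + m * q ^ suc m                    ∎))
    where open ≡-Reasoning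

module ShortIntervals (F : FiniteField) where
  open PolynomialRing F
  open MonicDivision F
  open Enumeration F
  open Irreducibles F
  open PrimePowerSums F
  open PrimePolynomialTheorem F

  -- Λ(f) for monic f: in Defs only the scalar c = 1 can represent a monic f as c P^k.
  ΛPower : (d : ℕ) → Vec Carrier d → ℕ → P → ℕ
  ΛPower d v k f = if ⌊ 1 ≤? k ⌋ ∧ irreducible? d (monic F v) ∧ (pow (monic F v) k =? f) then d else 0

  sc-1≡ : ∀ p → sc 1# p ≡ p
  sc-1≡ []      = refl
  sc-1≡ (x ∷ p) = cong₂ _∷_ (C.*-identityˡ x) (sc-1≡ p)

  isNonzero-1 : isNonzero F 1# ≡ true
  isNonzero-1 = cong not (if-dec-false (1# ≟F 0#) (λ 1≡0 → 0≢1 (sym 1≡0)))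
    where
      if-dec-false : ∀ {Q : Set} (dq : Dec Q) → ¬ Q → ⌊ dq ⌋ ≡ false
      if-dec-false (yes q) ¬q = ⊥-elim (¬q q)
      if-dec-false (no _)  _  = refl

  scalar-is-1 : ∀ {n f} → Monic n f → ∀ d (v : Vec Carrier d) k c → sc c (pow (monic F v) k) ≡ f → c ≡ 1#
  scalar-is-1 {n} {f} mf d v k c cP^k≡f = begin
    c                              ≡⟨ C.*-identityʳ c ⟨
    c *F 1#                        ≡⟨ cong (c *F_) (leading mP^k) ⟨
    c *F coef P^k (d * k)          ≡⟨ coef-sc c P^k (d * k) ⟨
    coef (sc c P^k) (d * k)        ≡⟨ cong (λ z → coef z (d * k)) cP^k≡f ⟩
    coef f (d * k)                 ≡⟨ cong (coef f) dk≡n ⟩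
    coef f n                       ≡⟨ leading mf ⟩
    1#                             ∎
    where
      open ≡-Reasoning
      P^k = pow (monic F v) k
      mP^k = Monic-pow (monic-Monic v) k
      dk≡n : d * k ≡ n
      dk≡n = suc-injective (trans (sym (length≡ mP^k)) (trans (sym (length-map (c *F_) P^k)) (trans (cong length cP^k≡f) (length≡ mf))))

  Λ-monic : ∀ {n f} → Monic n f → Λ F f ≡ ΣPowers (suc n) (λ d v k → ΛPower d v k f)
  Λ-monic {n} {f} mf = trans (cong (λ N → ΛN F N f) (length≡ mf)) (ΣPowers-cong (suc n) only-c=1)
    where
      only-c=1 : ∀ d v k → Σl elements (λ c → if isNonzero F c ∧ ⌊ 1 ≤? k ⌋ ∧ isIrreducible F d v
                                                    ∧ (sc c (pow (monic F v) k) =? f) then d else 0) ≡ ΛPower d v k f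
      only-c=1 d v k = trans (Σ-cong elements term) (Σ-indicator _≟F_ elements elements-unique 1# (elements-complete 1#) _)
        where
          term : ∀ c → (if isNonzero F c ∧ ⌊ 1 ≤? k ⌋ ∧ isIrreducible F d v ∧ (sc c (pow (monic F v) k) =? f) then d else 0)
                       ≡ (if ⌊ c ≟F 1# ⌋ then ΛPower d v k f else 0)
          term c with c ≟F 1#
          ... | yes refl = cong₂ (λ b p → if b ∧ ⌊ 1 ≤? k ⌋ ∧ irreducible? d (monic F v) ∧ (p =? f) then d else 0)
                                 isNonzero-1 (sc-1≡ (pow (monic F v) k))
          ... | no c≢1 with sc c (pow (monic F v) k) =? f in cP^k=f
          ...   | true  = ⊥-elim (c≢1 (scalar-is-1 mf d v k c (=?-sound _ _ cP^k=f)))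
          ...   | false = no-match (isNonzero F c) ⌊ 1 ≤? k ⌋ (irreducible? d (monic F v))
            where
              no-match : ∀ a b e → (if a ∧ b ∧ e ∧ false then d else 0) ≡ 0
              no-match true true true  = refl
              no-match true true false = refl
              no-match true false e    = refl
              no-match false b e       = refl

  constCoeff≡coef : ∀ p → constCoeff F p ≡ coef p 0
  constCoeff≡coef []      = refl
  constCoeff≡coef (x ∷ p) = refl

  coef0-⊗ : ∀ a b → coef (a ⊗ b) 0 ≡ coef a 0 *F coef b 0
  coef0-⊗ []      b = sym (C.zeroˡ _)
  coef0-⊗ (x ∷ a) b = trans (coef-⊕ (sc x b) (sh (a ⊗ b)) 0) (trans (C.+-identityʳ _) (coef-sc x b 0))

  no-zero-divisors : ∀ x y → x *F y ≡ 0# → x ≢ 0# → y ≡ 0#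
  no-zero-divisors x y xy≡0 x≢0 = let (x⁻¹ , xx⁻¹≡1) = inverse x x≢0 in begin
    y                  ≡⟨ C.*-identityˡ y ⟨
    1# *F y            ≡⟨ cong (_*F y) (trans (C.*-comm x⁻¹ x) xx⁻¹≡1) ⟨
    (x⁻¹ *F x) *F y    ≡⟨ C.*-assoc x⁻¹ x y ⟩
    x⁻¹ *F (x *F y)    ≡⟨ cong (x⁻¹ *F_) xy≡0 ⟩
    x⁻¹ *F 0#          ≡⟨ C.zeroʳ x⁻¹ ⟩
    0#                 ∎
    where open ≡-Reasoning

  pow-vanishes-at-0 : ∀ Q k → coef (pow Q k) 0 ≡ 0# → coef Q 0 ≡ 0#
  pow-vanishes-at-0 Q zero    1≡0 = ⊥-elim (0≢1 (sym 1≡0))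
  pow-vanishes-at-0 Q (suc k) e with coef Q 0 ≟F 0#
  ... | yes Q0≡0 = Q0≡0
  ... | no  Q0≢0 = pow-vanishes-at-0 Q k (no-zero-divisors (coef Q 0) _ (trans (sym (coef0-⊗ Q (pow Q k))) e) Q0≢0)

  T : P
  T = 0# ∷ 1# ∷ []

  Monic-T : Monic 1 T
  Monic-T = monicₚ refl refl

  Irreducible-T : Irreducible 1 T
  Irreducible-T = irreducibleₚ refl

  irreducible-at-0 : ∀ {d Q} → Monic d Q → Irreducible d Q → coef Q 0 ≡ 0# → Q ≡ T
  irreducible-at-0 {zero}  {Q}      mQ iQ _ = ⊥-elim (<⇒≱ (Irreducible-deg {0} {Q} iQ) z≤n)
  irreducible-at-0 {suc d} {x ∷ Q'} (monicₚ l t) iQ x≡0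
    with irreducible-divisor-deg (monicₚ l t) iQ Monic-T (Q' , ≈-sym (≈-trans (⊕-cong (sc-0 Q') (sh-cong (⊗-identityˡ Q'))) (cons≈ (sym x≡0) ≈-refl)))
  ... | inj₂ refl = cong₂ _∷_ x≡0 (Monic-0 (monicₚ (suc-injective l) t))

  T^k-vanishes-at-0 : ∀ k → 1 ≤ k → coef (pow T k) 0 ≡ 0#
  T^k-vanishes-at-0 (suc k) _ = trans (coef0-⊗ T (pow T k)) (C.zeroˡ _)

  ΛexactUnit : ℕ → (d : ℕ) → Vec Carrier d → ℕ → ℕ
  ΛexactUnit n d v k = if (irreducible? d (monic F v) ∧ ⌊ 1 ≤? k ⌋ ∧ ⌊ d * k ≟ℕ n ⌋) ∧ isNonzero F (constCoeff F (pow (monic F v) k))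
                       then d else 0

  if-split : ∀ a z (d : ℕ) → (if a then d else 0) ≡ (if a ∧ z then d else 0) + (if a ∧ not z then d else 0)
  if-split true  true  d = sym (+-identityʳ d)
  if-split true  false d = refl
  if-split false z     d = refl

  T^n-indicator : ℕ → (d : ℕ) → Vec Carrier d → ℕ → ℕ
  T^n-indicator n d v k = if (monic F v =? T) ∧ ⌊ k ≟ℕ n ⌋ then 1 else 0

  Λexact-split : ∀ {n} → 1 ≤ n → ∀ d v k →
                 Λexact n d v k ≡ ΛexactUnit n d v k + T^n-indicator n d v k
  Λexact-split {n} 1≤n d v k =
    trans (if-split (irreducible? d Pv ∧ ⌊ 1 ≤? k ⌋ ∧ ⌊ d * k ≟ℕ n ⌋) (isNonzero F (constCoeff F (pow Pv k))) d)
          (cong (ΛexactUnit n d v k +_) (if-cong (bool-ext (both ∘ vanishing) (vanishing-T ∘ =T)) (d≡1 ∘ proj₁ ∘ vanishing)))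
    where
      Pv = monic F v
      d≡1 : Pv ≡ T → d ≡ 1
      d≡1 Pv≡T = Monic-deg-unique (monic-Monic v) (subst (Monic 1) (sym Pv≡T) Monic-T)
      zero-test : ∀ c → not (isNonzero F c) ≡ ⌊ c ≟F 0# ⌋
      zero-test c with c ≟F 0#
      ... | yes _ = refl
      ... | no  _ = refl
      both : Pv ≡ T × k ≡ n → ((Pv =? T) ∧ ⌊ k ≟ℕ n ⌋) ≡ true
      both (Pv≡T , k≡n) = cong₂ _∧_ (=?-≡ Pv≡T) (true-⌊⌋ (k ≟ℕ n) k≡n)
      =T : ((Pv =? T) ∧ ⌊ k ≟ℕ n ⌋) ≡ true → Pv ≡ T × k ≡ n
      =T e = let (Pv=T , k=n) = ∧-true {Pv =? T} e in =?-sound _ _ Pv=T , ⌊⌋-true (k ≟ℕ n) k=n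
      vanishing : ((irreducible? d Pv ∧ ⌊ 1 ≤? k ⌋ ∧ ⌊ d * k ≟ℕ n ⌋) ∧ not (isNonzero F (constCoeff F (pow Pv k)))) ≡ true → Pv ≡ T × k ≡ n
      vanishing e = Pv≡T , trans (sym (*-identityˡ k)) (trans (cong (_* k) (sym (d≡1 Pv≡T))) (⌊⌋-true (d * k ≟ℕ n) dk=n))
        where
          a∧b∧c = proj₁ (∧-true {irreducible? d Pv ∧ ⌊ 1 ≤? k ⌋ ∧ ⌊ d * k ≟ℕ n ⌋} e)
          irr = proj₁ (∧-true {irreducible? d Pv} a∧b∧c)
          dk=n = proj₂ (∧-true {⌊ 1 ≤? k ⌋} (proj₂ (∧-true {irreducible? d Pv} a∧b∧c)))
          P^k0≡0 = trans (sym (constCoeff≡coef (pow Pv k))) (⌊⌋-true (constCoeff F (pow Pv k) ≟F 0#) (trans (sym (zero-test _)) (proj₂ (∧-true {irreducible? d Pv ∧ ⌊ 1 ≤? k ⌋ ∧ ⌊ d * k ≟ℕ n ⌋} e))))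
          Pv≡T = irreducible-at-0 (monic-Monic v) (irreducibleₚ irr) (pow-vanishes-at-0 Pv k P^k0≡0)
      vanishing-T : Pv ≡ T × k ≡ n → ((irreducible? d Pv ∧ ⌊ 1 ≤? k ⌋ ∧ ⌊ d * k ≟ℕ n ⌋) ∧ not (isNonzero F (constCoeff F (pow Pv k)))) ≡ true
      vanishing-T (Pv≡T , refl) with d≡1 Pv≡T
      ... | refl rewrite Pv≡T = cong₂ _∧_ (cong₂ _∧_ (passes Irreducible-T) (cong₂ _∧_ (true-⌊⌋ (1 ≤? k) 1≤n) (true-⌊⌋ (1 * k ≟ℕ k) (*-identityˡ k))))
                                          (trans (zero-test _) (true-⌊⌋ (constCoeff F (pow T k) ≟F 0#) (trans (constCoeff≡coef (pow T k)) (T^k-vanishes-at-0 k 1≤n))))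

  H : P → ℕ
  H f = if isNonzero F (constCoeff F f) then Λ F f else 0

  Σ-ΛPower-unit : ∀ n d v k → Σl (Monics F n) (λ f → if isNonzero F (constCoeff F f) then ΛPower d v k f else 0)
                                ≡ ΛexactUnit n d v k
  Σ-ΛPower-unit n d v k = begin
    Σl (Monics F n) (λ f → if nz f then ΛPower d v k f else 0)
      ≡⟨ Σ-cong (Monics F n) term ⟩
    Σl (Monics F n) (λ f → if ⌊ 1 ≤? k ⌋ ∧ irr then (if f =? P^k then Y else 0) else 0)
      ≡⟨ Σ-if (Monics F n) (⌊ 1 ≤? k ⌋ ∧ irr) _ ⟩
    (if ⌊ 1 ≤? k ⌋ ∧ irr then Σl (Monics F n) (λ f → if f =? P^k then Y else 0) else 0)
      ≡⟨ if-cong refl (λ _ → Σ-Monics-indicator (Monic-pow (monic-Monic v) k) n Y) ⟩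
    (if ⌊ 1 ≤? k ⌋ ∧ irr then (if ⌊ n ≟ℕ d * k ⌋ then Y else 0) else 0)
      ≡⟨ trans (cong (λ z → if ⌊ 1 ≤? k ⌋ ∧ irr then z else 0) (sym (if-∧ ⌊ n ≟ℕ d * k ⌋ (nz P^k) d))) (sym (if-∧ (⌊ 1 ≤? k ⌋ ∧ irr) (⌊ n ≟ℕ d * k ⌋ ∧ nz P^k) d)) ⟩
    (if (⌊ 1 ≤? k ⌋ ∧ irr) ∧ (⌊ n ≟ℕ d * k ⌋ ∧ nz P^k) then d else 0)
      ≡⟨ if-cong (trans (cong (λ c → (⌊ 1 ≤? k ⌋ ∧ irr) ∧ (c ∧ nz P^k)) (⌊≟⌋-sym n (d * k))) (∧-shuffle irr ⌊ 1 ≤? k ⌋ ⌊ d * k ≟ℕ n ⌋ (nz P^k))) (λ _ → refl) ⟩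
    ΛexactUnit n d v k ∎
    where
      open ≡-Reasoning
      irr = irreducible? d (monic F v)
      P^k = pow (monic F v) k
      nz : P → Bool
      nz f = isNonzero F (constCoeff F f)
      Y = if nz P^k then d else 0
      term : ∀ f → (if nz f then ΛPower d v k f else 0) ≡ (if ⌊ 1 ≤? k ⌋ ∧ irr then (if f =? P^k then Y else 0) else 0)
      term f = begin
        (if nz f then ΛPower d v k f else 0)
          ≡⟨ cong (λ z → if nz f then z else 0) (if-∧∧ ⌊ 1 ≤? k ⌋ irr (P^k =? f) d) ⟩
        (if nz f then (if ⌊ 1 ≤? k ⌋ ∧ irr then (if P^k =? f then d else 0) else 0) else 0)
          ≡⟨ if-swap (nz f) (⌊ 1 ≤? k ⌋ ∧ irr) (if P^k =? f then d else 0) ⟩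
        (if ⌊ 1 ≤? k ⌋ ∧ irr then (if nz f then (if P^k =? f then d else 0) else 0) else 0)
          ≡⟨ cong (λ z → if ⌊ 1 ≤? k ⌋ ∧ irr then z else 0)
               (trans (if-swap (nz f) (P^k =? f) d) (if-cong (=?-sym P^k f) (λ e → cong (λ g → if nz g then d else 0) (sym (=?-sound _ _ e))))) ⟩
        (if ⌊ 1 ≤? k ⌋ ∧ irr then (if f =? P^k then Y else 0) else 0) ∎

  ΣPowers-T^n : ∀ n → ΣPowers (suc n) (T^n-indicator n) ≡ 1
  ΣPowers-T^n n = begin
    ΣPowers (suc n) (T^n-indicator n)
      ≡⟨ Σ-cong (upTo (suc (suc n))) (λ d → Σ-cong (allVecs F d) (λ v →
           trans (Σ-cong (upTo (suc (suc n))) (λ k → if-∧ (monic F v =? T) ⌊ k ≟ℕ n ⌋ 1))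
                 (trans (Σ-if (upTo (suc (suc n))) (monic F v =? T) _)
                        (if-cong refl (λ _ → Σ-upTo-indicator (suc n) n 1 (n≤1+n n)))))) ⟩
    Σl (upTo (suc (suc n))) (λ d → Σl (allVecs F d) (λ v → if monic F v =? T then 1 else 0))
      ≡⟨ Σ-allMonics-indicator (suc n) Monic-T (s≤s z≤n) (λ _ → 1) ⟩
    1 ∎
    where open ≡-Reasoning

  Σ-H : ∀ n → 1 ≤ n → Σl (Monics F n) H ≡ q ^ n ∸ 1
  Σ-H n 1≤n = begin
    Σl (Monics F n) H
      ≡⟨ Σ-cong∈ (Monics F n) (λ f f∈ → trans (cong (λ z → if nz f then z else 0) (Λ-monic (∈Monics⇒Monic f∈)))
                                               (sym (ΣPowers-if (suc n) (nz f) (λ d v k → ΛPower d v k f)))) ⟩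
    Σl (Monics F n) (λ f → ΣPowers (suc n) (λ d v k → if nz f then ΛPower d v k f else 0))
      ≡⟨ Σ-ΣPowers (Monics F n) (suc n) (λ f d v k → if nz f then ΛPower d v k f else 0) ⟩
    ΣPowers (suc n) (λ d v k → Σl (Monics F n) (λ f → if nz f then ΛPower d v k f else 0))
      ≡⟨ ΣPowers-cong (suc n) (Σ-ΛPower-unit n) ⟩
    ΣPowers (suc n) (ΛexactUnit n)
      ≡⟨ m+n∸n≡m _ 1 ⟨
    ΣPowers (suc n) (ΛexactUnit n) + 1 ∸ 1
      ≡⟨ cong (λ z → ΣPowers (suc n) (ΛexactUnit n) + z ∸ 1) (ΣPowers-T^n n) ⟨
    ΣPowers (suc n) (ΛexactUnit n) + ΣPowers (suc n) (T^n-indicator n) ∸ 1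
      ≡⟨ cong (_∸ 1) (trans (ΣPowers-cong (suc n) (Λexact-split 1≤n)) (ΣPowers-+ (suc n) (ΛexactUnit n) (T^n-indicator n))) ⟨
    ΣPowers (suc n) (Λexact n) ∸ 1
      ≡⟨ cong (_∸ 1) (primePolynomialTheorem (suc n) n 1≤n (n≤1+n n)) ⟩
    q ^ n ∸ 1 ∎
    where
      open ≡-Reasoning
      nz : P → Bool
      nz f = isNonzero F (constCoeff F f)

  -- x ↦ x + g permutes F, so sums over F are translation invariant.
  Σ-elements-shift : ∀ (Φ : Carrier → ℕ) g → Σl elements (λ x → Φ (x +F g)) ≡ Σl elements Φ
  Σ-elements-shift Φ g = begin
    Σl elements (λ x → Φ (x +F g))
      ≡⟨ Σ-cong elements (λ x → sym (point (x +F g))) ⟩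
    Σl elements (λ x → Σl elements (λ y → if ⌊ y ≟F (x +F g) ⌋ then Φ y else 0))
      ≡⟨ Σ-swap elements elements _ ⟩
    Σl elements (λ y → Σl elements (λ x → if ⌊ y ≟F (x +F g) ⌋ then Φ y else 0))
      ≡⟨ Σ-cong elements (λ y → trans (Σ-cong elements (λ x → if-cong (bool-ext (to x y) (from x y)) (λ _ → refl)))
                                       (Σ-indicator _≟F_ elements elements-unique (y +F -F g) (elements-complete _) (Φ y))) ⟩
    Σl elements Φ ∎
    where
      open ≡-Reasoning
      point : ∀ z → Σl elements (λ y → if ⌊ y ≟F z ⌋ then Φ y else 0) ≡ Φ z
      point z = trans (Σ-cong elements (λ y → if-cong refl (λ y=z → cong Φ (⌊⌋-true (y ≟F z) y=z))))
                      (Σ-indicator _≟F_ elements elements-unique z (elements-complete z) (Φ z))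
      to : ∀ x y → ⌊ y ≟F (x +F g) ⌋ ≡ true → ⌊ x ≟F (y +F -F g) ⌋ ≡ true
      to x y e with ⌊⌋-true (y ≟F (x +F g)) e
      ... | refl = true-⌊⌋ (x ≟F _) (sym (trans (C.+-assoc x g (-F g)) (trans (cong (x +F_) (C.-‿inverseʳ g)) (C.+-identityʳ x))))
      from : ∀ x y → ⌊ x ≟F (y +F -F g) ⌋ ≡ true → ⌊ y ≟F (x +F g) ⌋ ≡ true
      from x y e with ⌊⌋-true (x ≟F (y +F -F g)) e
      ... | refl = true-⌊⌋ (y ≟F _) (sym (trans (C.+-assoc y (-F g) g) (trans (cong (y +F_) (C.-‿inverseˡ g)) (C.+-identityʳ y))))

  -- A ↦ A + g permutes M_n when deg g < n: it shifts each lower coefficient by a constant.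
  Σ-translate : ∀ n gs → length gs ≤ n → (K : P → ℕ) →
                Σl (allVecs F n) (λ v → K (monic F v ⊕ gs)) ≡ Σl (allVecs F n) (λ v → K (monic F v))
  Σ-translate n       []       _        K = Σ-cong (allVecs F n) (λ v → cong K (⊕-[] (monic F v)))
    where
      ⊕-[] : ∀ p → p ⊕ [] ≡ p
      ⊕-[] []      = refl
      ⊕-[] (x ∷ p) = refl
  Σ-translate (suc n) (g ∷ gs) (s≤s le) K = begin
    Σl (concatMap (λ x → map (x ∷ᵥ_) (allVecs F n)) elements) (λ v → K (monic F v ⊕ (g ∷ gs)))
      ≡⟨ Σ-concatMap elements (λ x → map (x ∷ᵥ_) (allVecs F n)) _ ⟩
    Σl elements (λ x → Σl (map (x ∷ᵥ_) (allVecs F n)) (λ v → K (monic F v ⊕ (g ∷ gs))))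
      ≡⟨ Σ-cong elements (λ x → trans (Σ-map (allVecs F n) (x ∷ᵥ_) _) (Σ-translate n gs le (λ p → K ((x +F g) ∷ p)))) ⟩
    Σl elements (λ x → Φ (x +F g))
      ≡⟨ Σ-elements-shift Φ g ⟩
    Σl elements Φ
      ≡⟨ Σ-cong elements (λ x → Σ-map (allVecs F n) (x ∷ᵥ_) _) ⟨
    Σl elements (λ x → Σl (map (x ∷ᵥ_) (allVecs F n)) (λ v → K (monic F v)))
      ≡⟨ Σ-concatMap elements (λ x → map (x ∷ᵥ_) (allVecs F n)) _ ⟨
    Σl (concatMap (λ x → map (x ∷ᵥ_) (allVecs F n)) elements) (λ v → K (monic F v)) ∎
    where
      open ≡-Reasoning
      Φ : Carrier → ℕ
      Φ y = Σl (allVecs F n) (λ v → K (y ∷ monic F v))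

-- Lemma 4.3, multiplied through by q^n:  Σ_{A ∈ M_n} ν(A;h) = q^{h+1} (q^n − 1).
lemma4p3 : (F : FiniteField) (n h : ℕ) → 0 < h → h < n →
    sum (map (λ A → ν F A h) (Monics F n))
    ≡ card F ^ suc h * (card F ^ n ∸ 1)
lemma4p3 F n h _ h<n = begin
  Σl (Monics F n) (λ A → Σl (allVecs F (suc h)) (λ g → H (A ⊕ toList g)))
    ≡⟨ Σ-map (allVecs F n) (monic F) _ ⟩
  Σl (allVecs F n) (λ v → Σl (allVecs F (suc h)) (λ g → H (monic F v ⊕ toList g)))
    ≡⟨ Σ-swap (allVecs F n) (allVecs F (suc h)) _ ⟩
  Σl (allVecs F (suc h)) (λ g → Σl (allVecs F n) (λ v → H (monic F v ⊕ toList g)))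
    ≡⟨ Σ-cong (allVecs F (suc h)) (λ g → Σ-translate n (toList g) (subst (_≤ n) (sym (length-toList g)) h<n) H) ⟩
  Σl (allVecs F (suc h)) (λ _ → Σl (allVecs F n) (λ v → H (monic F v)))
    ≡⟨ Σ-const (allVecs F (suc h)) _ ⟩
  Σl (allVecs F n) (λ v → H (monic F v)) * length (allVecs F (suc h))
    ≡⟨ cong (_* length (allVecs F (suc h))) (Σ-map (allVecs F n) (monic F) H) ⟨
  Σl (Monics F n) H * length (allVecs F (suc h))
    ≡⟨ cong₂ _*_ (Σ-H n (≤-trans (s≤s z≤n) h<n)) (length-allVecs (suc h)) ⟩
  (q ^ n ∸ 1) * q ^ suc h
    ≡⟨ *-comm _ (q ^ suc h) ⟩
  q ^ suc h * (q ^ n ∸ 1) ∎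
  where
    open ≡-Reasoning
    open PolynomialRing F using (_⊕_)
    open Enumeration F using (q; length-allVecs)
    open ShortIntervals F using (H; Σ-H; Σ-translate)
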